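{- Let $h\geq r$ be positive integers and let $0<\beta<1$ be a real. There is a positive real $\alpha$ depending on $h,r$ and $\beta$ such that the following is true. Let $G$ be any graph on $n$ vertices and let $p=p_r(G)$. For any $i,j\in[h]$, let $\mathcal{A}^*_{i,j}$ denote the set of $i$-good sequences of length $j$ relative to $(\alpha,\beta,h,r)$ in $V(G)$ that have no repetition. If $p>4jn^{ -1/r}$, then for each $i\in[h]$ and $r\leq j\leq h$, \[ \sum_{S\in\mathcal{A}^*_{i,j}}|N(S)|^r\geq\left(\frac{1}{2^{j+1}}-\beta\right)n^{j+r}p^{jr}. \]
   Context: All graphs are finite simple graphs. For a positive integer $r$, $p_r(G)=t_{K_{1,r}}(G)^{1/r}$ where $t_{K_{1,r}}(G)=\frac{1}{|G|^{r+1}}\sum_{v\in V(G)}d(v)^r$. A sequence in a set $W$ is a finite sequence of elements of $W$ (repetitions allowed); its length is its number of terms. For a sequence $S$ in $V(G)$, $N(S)$ is the set of vertices adjacent to every vertex of $S$; a sequence in $N(S)$ is a sequence all of whose terms lie in $N(S)$. Goodness relative to $(\alpha,\beta,h,r)$: for an $n$-vertex graph $G$ let $p=p_r(G)$. A sequence $T$ in $V(G)$ is $0$-good if $|N(T)|\geq \alpha p^{|T|}n$. For $1\leq i\leq h$, a sequence $S$ in $V(G)$ of length at most $h$ is $i$-good if $S$ is $0$-good and, for each $|S|\leq k\leq h$, the number of $(i-1)$-good sequences of length $k$ in $N(S)$ is at least $(1-\beta)|N(S)|^k$.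
   Formalization: The parameter β is rational rather than real, and the constant α is taken in the rationals. -}

module Defs where

open import Data.Bool using (Bool; true; false; _∧_; if_then_else_)
open import Data.Nat as ℕ using (ℕ; zero; suc)
open import Data.Fin using (Fin; _≟_)
open import Data.List using (List; []; _∷_; length; map; filterᵇ; concatMap; allFin; upTo)
open import Data.Bool.ListAction using (all)
open import Data.Nat.ListAction using (sum)
open import Data.Integer using (+_)
open import Data.Rational using (ℚ; _≤ᵇ_; _*_; _+_; _-_; _/_; 0ℚ; 1ℚ)
open import Relation.Binary.PropositionalEquality using (_≡_)
open import Relation.Nullary using (does)

ℕ→ℚ : ℕ → ℚ
ℕ→ℚ m = + m / 1

_^ℚ_ : ℚ → ℕ → ℚ
q ^ℚ zero = 1ℚ
q ^ℚ suc k = q * (q ^ℚ k)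

-- a / b as a rational (0 when b = 0)
divℕ : ℕ → ℕ → ℚ
divℕ a zero = 0ℚ
divℕ a (suc b) = + a / suc b

record Graph (n : ℕ) : Set where
  field
    adj   : Fin n → Fin n → Bool
    sym   : ∀ u v → adj u v ≡ adj v u
    irref : ∀ v → adj v v ≡ false
open Graph public

module _ {n : ℕ} (G : Graph n) where

  count : {A : Set} → (A → Bool) → List A → ℕ
  count P [] = 0
  count P (x ∷ xs) = if P x then suc (count P xs) else count P xs

  deg : Fin n → ℕ
  deg v = count (adj G v) (allFin n)

  -- t_{K_{1,r}}(G) = (Σ_v d(v)^r) / n^{r+1}   (defined as 0 when n = 0)
  tStar : ℕ → ℚ
  tStar r = divℕ (sum (map (λ v → deg v ℕ.^ r) (allFin n))) (n ℕ.^ suc r)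

  inN : List (Fin n) → Fin n → Bool
  inN S w = all (λ s → adj G s w) S

  nbhd : List (Fin n) → ℕ
  nbhd S = count (inN S) (allFin n)

  seqs : ℕ → List (List (Fin n))
  seqs zero = [] ∷ []
  seqs (suc k) = concatMap (λ v → map (v ∷_) (seqs k)) (allFin n)

  noRep : List (Fin n) → Bool
  noRep [] = true
  noRep (x ∷ xs) = all (λ y → Data.Bool.not (does (x ≟ y))) xs ∧ noRep xs

  -- Goodness relative to (α, β, h, r), with p = p_r(G) = tStar r ^ (1/r).
  -- 0-good: |N(T)| ≥ α p^{|T|} n, stated equivalently (both sides ≥ 0) as
  --   |N(T)|^r ≥ α^r · tStar^{|T|} · n^r.
  module Goodness (α β : ℚ) (h r : ℕ) where

    zeroGood : List (Fin n) → Bool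
    zeroGood T = (α ^ℚ r) * (tStar r ^ℚ length T) * (ℕ→ℚ n ^ℚ r) ≤ᵇ ℕ→ℚ (nbhd T ℕ.^ r)

    range : ℕ → ℕ → List ℕ
    range a b = filterᵇ (λ k → does (a ℕ.≤? k)) (upTo (suc b))

    good : ℕ → List (Fin n) → Bool
    good zero T = zeroGood T
    good (suc i) S =
      does (length S ℕ.≤? h) ∧ zeroGood S ∧
      all (λ k → (1ℚ - β) * (ℕ→ℚ (nbhd S) ^ℚ k)
                   ≤ᵇ ℕ→ℚ (count (λ T → all (inN S) T ∧ good i T) (seqs k)))
          (range (length S) h)

    Astar : ℕ → ℕ → List (List (Fin n))
    Astar i j = filterᵇ (λ S → good i S ∧ noRep S) (seqs j)

    sumAstar : ℕ → ℕ → ℕ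
    sumAstar i j = sum (map (λ S → nbhd S ℕ.^ r) (Astar i j))

{-# OPTIONS --safe #-}
-- Write t = p^r = D / n^(r+1), where D = Σ_v d(v)^r is also Σ_{|T| = r} |N(T)|. Since an
-- injective j-sequence in N(T) can be built greedily in (|N(T)| ∸ j)^j ways, double counting
-- and the power-mean inequality show that the injective j-sequences S carry
-- Σ |N(S)|^r ≥ n^(j+r) t^j / 2^j as soon as D ≥ 2 j n^r, which the density hypothesis gives.
-- It remains to bound the mass Σ |N(S)|^r of the sequences that are not i-good by
-- β n^(j+r) t^j. A sequence that is not (i+1)-good is either not 0-good, so |N(S)| < α p^|S| n,
-- or has more than β |N(S)|^k extensions of some length k in N(S) that are not i-good; double
-- counting turns the mass of the latter into the bad mass at level i of longer sequences.
-- Throughout, p is replaced by an integer ratio a / b with p ≤ a / b ≤ 2 p, so that the whole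
-- argument runs in ℕ. Induction on i, with a constant E that grows at each level, bounds the
-- m-th moment of |N(T)| over bad length-k sequences T by n^(k+m) (a / b)^(km) / E; h levels of
-- growth starting from E = 2^(hr) B, where 1 / B ≤ β, determine α.
module Submission where

open import Defs hiding (sym)
open import Data.Nat using (ℕ)
open import Data.Rational using (ℚ; 0ℚ)

module Sums where

  open import Data.Bool using (Bool; true; false; _∧_)
  open import Data.Nat
  open import Data.Nat.Properties
  open import Data.Nat.ListAction using (sum)
  open import Data.Nat.Tactic.RingSolver using (solve-∀)
  open import Data.List using (List; []; _∷_; length; map; concatMap; _++_; filterᵇ)
  open import Data.List.Membership.Propositional using (_∈_)
  open import Data.List.Relation.Unary.Any using (here; there)
  open import Relation.Binary.PropositionalEquality

  ∑ : {A : Set} → List A → (A → ℕ) → ℕ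
  ∑ xs f = sum (map f xs)

  𝕀 : Bool → ℕ
  𝕀 true = 1
  𝕀 false = 0

  𝕀-∧ : ∀ a b → 𝕀 (a ∧ b) ≡ 𝕀 a * 𝕀 b
  𝕀-∧ true b = sym (+-identityʳ (𝕀 b))
  𝕀-∧ false b = refl

  𝕀≤1 : ∀ a → 𝕀 a ≤ 1
  𝕀≤1 true = ≤-refl
  𝕀≤1 false = z≤n

  module _ {A : Set} where

    ∑-mono-≤ : ∀ (xs : List A) {f g : A → ℕ} → (∀ x → x ∈ xs → f x ≤ g x) → ∑ xs f ≤ ∑ xs g
    ∑-mono-≤ [] f≤g = z≤n
    ∑-mono-≤ (x ∷ xs) f≤g = +-mono-≤ (f≤g x (here refl)) (∑-mono-≤ xs (λ y y∈ → f≤g y (there y∈)))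

    ∑-cong : ∀ (xs : List A) {f g : A → ℕ} → (∀ x → x ∈ xs → f x ≡ g x) → ∑ xs f ≡ ∑ xs g
    ∑-cong xs f≡g = ≤-antisym (∑-mono-≤ xs (λ x x∈ → ≤-reflexive (f≡g x x∈)))
                              (∑-mono-≤ xs (λ x x∈ → ≤-reflexive (sym (f≡g x x∈))))

    ∑-distrib-+ : ∀ (xs : List A) (f g : A → ℕ) → ∑ xs (λ x → f x + g x) ≡ ∑ xs f + ∑ xs g
    ∑-distrib-+ [] f g = refl
    ∑-distrib-+ (x ∷ xs) f g rewrite ∑-distrib-+ xs f g = swap (f x) (g x) (∑ xs f) (∑ xs g)
      where
      swap : ∀ a b c d → a + b + (c + d) ≡ a + c + (b + d)
      swap = solve-∀

    ∑-*ˡ : ∀ (xs : List A) (c : ℕ) (f : A → ℕ) → ∑ xs (λ x → c * f x) ≡ c * ∑ xs f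
    ∑-*ˡ [] c f = sym (*-zeroʳ c)
    ∑-*ˡ (x ∷ xs) c f rewrite ∑-*ˡ xs c f = sym (*-distribˡ-+ c (f x) (∑ xs f))

    ∑-*ʳ : ∀ (xs : List A) (c : ℕ) (f : A → ℕ) → ∑ xs (λ x → f x * c) ≡ ∑ xs f * c
    ∑-*ʳ xs c f = trans (∑-cong xs (λ x _ → *-comm (f x) c)) (trans (∑-*ˡ xs c f) (*-comm c (∑ xs f)))

    ∑-++ : ∀ (xs ys : List A) (f : A → ℕ) → ∑ (xs ++ ys) f ≡ ∑ xs f + ∑ ys f
    ∑-++ [] ys f = refl
    ∑-++ (x ∷ xs) ys f rewrite ∑-++ xs ys f = sym (+-assoc (f x) (∑ xs f) (∑ ys f))

    ∑-const : ∀ (xs : List A) (c : ℕ) → ∑ xs (λ _ → c) ≡ length xs * c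
    ∑-const [] c = refl
    ∑-const (x ∷ xs) c = cong (c +_) (∑-const xs c)

    ∑-≤-length* : ∀ (xs : List A) (c : ℕ) (f : A → ℕ) → (∀ x → x ∈ xs → f x ≤ c) → ∑ xs f ≤ length xs * c
    ∑-≤-length* xs c f f≤c = subst (∑ xs f ≤_) (∑-const xs c) (∑-mono-≤ xs f≤c)

    ∑-∸ : ∀ (xs : List A) (f g : A → ℕ) → ∑ xs f ∸ ∑ xs g ≤ ∑ xs (λ x → f x ∸ g x)
    ∑-∸ [] f g = z≤n
    ∑-∸ (x ∷ xs) f g = begin
        f x + ∑ xs f ∸ (g x + ∑ xs g)     ≡⟨ ∸-+-assoc (f x + ∑ xs f) (g x) (∑ xs g) ⟨
        f x + ∑ xs f ∸ g x ∸ ∑ xs g       ≤⟨ ∸-monoˡ-≤ (∑ xs g) (+-∸-≤ (f x) (∑ xs f) (g x)) ⟩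
        (f x ∸ g x) + ∑ xs f ∸ ∑ xs g     ≤⟨ +-∸-assoc-≤ (f x ∸ g x) (∑ xs f) (∑ xs g) ⟩
        (f x ∸ g x) + (∑ xs f ∸ ∑ xs g)   ≤⟨ +-monoʳ-≤ (f x ∸ g x) (∑-∸ xs f g) ⟩
        (f x ∸ g x) + ∑ xs (λ x → f x ∸ g x) ∎
      where
      open ≤-Reasoning
      +-∸-≤ : ∀ a b c → a + b ∸ c ≤ (a ∸ c) + b
      +-∸-≤ a b zero = ≤-refl
      +-∸-≤ zero b (suc c) = m∸n≤m b (suc c)
      +-∸-≤ (suc a) b (suc c) = +-∸-≤ a b c
      +-∸-assoc-≤ : ∀ a b c → a + b ∸ c ≤ a + (b ∸ c)
      +-∸-assoc-≤ a b zero = ≤-refl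
      +-∸-assoc-≤ a zero (suc c) = m∸n≤m (a + 0) (suc c)
      +-∸-assoc-≤ a (suc b) (suc c) = ≤-trans (≤-reflexive (cong (_∸ suc c) (+-suc a b))) (+-∸-assoc-≤ a b c)

    ∑-filterᵇ : ∀ (P : A → Bool) (f : A → ℕ) xs → ∑ (filterᵇ P xs) f ≡ ∑ xs (λ x → 𝕀 (P x) * f x)
    ∑-filterᵇ P f [] = refl
    ∑-filterᵇ P f (x ∷ xs) with P x
    ... | true = cong₂ _+_ (sym (+-identityʳ (f x))) (∑-filterᵇ P f xs)
    ... | false = ∑-filterᵇ P f xs

  module _ {A B : Set} where

    ∑-map : ∀ (g : A → B) (xs : List A) (f : B → ℕ) → ∑ (map g xs) f ≡ ∑ xs (λ x → f (g x))
    ∑-map g [] f = refl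
    ∑-map g (x ∷ xs) f = cong (f (g x) +_) (∑-map g xs f)

    ∑-concatMap : ∀ (g : A → List B) (xs : List A) (f : B → ℕ) →
      ∑ (concatMap g xs) f ≡ ∑ xs (λ x → ∑ (g x) f)
    ∑-concatMap g [] f = refl
    ∑-concatMap g (x ∷ xs) f = trans (∑-++ (g x) (concatMap g xs) f) (cong (∑ (g x) f +_) (∑-concatMap g xs f))

    ∑-comm : ∀ (xs : List A) (ys : List B) (f : A → B → ℕ) →
      ∑ xs (λ x → ∑ ys (λ y → f x y)) ≡ ∑ ys (λ y → ∑ xs (λ x → f x y))
    ∑-comm [] ys f = sym (trans (∑-const ys 0) (*-zeroʳ (length ys)))
    ∑-comm (x ∷ xs) ys f = trans (cong (∑ ys (f x) +_) (∑-comm xs ys f))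
                                 (sym (∑-distrib-+ ys (f x) (λ y → ∑ xs (λ x → f x y))))
module NatPowers where

  open import Data.Nat
  open import Data.Nat.Properties
  open import Data.Nat.Tactic.RingSolver using (solve-∀)
  open import Relation.Binary.PropositionalEquality

  ^-distrib-* : ∀ x y m → (x * y) ^ m ≡ x ^ m * y ^ m
  ^-distrib-* x y zero = refl
  ^-distrib-* x y (suc m) rewrite ^-distrib-* x y m = interchange x y (x ^ m) (y ^ m)
    where
    interchange : ∀ x y p q → x * y * (p * q) ≡ x * p * (y * q)
    interchange = solve-∀

  ^-comm : ∀ x r k → (x ^ r) ^ k ≡ (x ^ k) ^ r
  ^-comm x r k = trans (^-*-assoc x r k) (trans (cong (x ^_) (*-comm r k)) (sym (^-*-assoc x k r)))

  m≤m^n : ∀ m n → 1 ≤ n → m ≤ m ^ n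
  m≤m^n zero (suc n) _ = z≤n
  m≤m^n (suc m) (suc n) _ = ≤-trans (≤-reflexive (sym (*-identityʳ (suc m)))) (*-monoʳ-≤ (suc m) (m^n>0 (suc m) n))

  1≤m^n : ∀ m n → 1 ≤ m → 1 ≤ m ^ n
  1≤m^n (suc m) n _ = m^n>0 (suc m) n

  ^-monoʳ-≤′ : ∀ m {x y} → 1 ≤ m → x ≤ y → m ^ x ≤ m ^ y
  ^-monoʳ-≤′ (suc m) _ x≤y = ^-monoʳ-≤ (suc m) x≤y

  m≤n*m′ : ∀ m n → 1 ≤ n → m ≤ n * m
  m≤n*m′ m (suc n) _ = m≤m+n m (n * m)
module PowerMean where

  open import Data.Nat
  open import Data.Nat.Properties
  open import Data.Nat.Tactic.RingSolver using (solve-∀)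
  open import Data.List using (List; length)
  open import Data.Product using (_,_)
  open import Data.Sum using (inj₁; inj₂)
  open import Relation.Binary.PropositionalEquality
  open Sums

  rearrangement-≤-ordered : ∀ a b j → a ≤ b → a * b ^ j + b * a ^ j ≤ a * a ^ j + b * b ^ j
  rearrangement-≤-ordered a b j a≤b with m≤n⇒∃[o]m+o≡n a≤b | m≤n⇒∃[o]m+o≡n (^-monoˡ-≤ j a≤b)
  ... | e , refl | f , a^j+f≡b^j rewrite sym a^j+f≡b^j =
    ≤-trans (m≤m+n _ (e * f)) (≤-reflexive (sym (identity a e (a ^ j) f)))
    where
    identity : ∀ a e p f → a * p + (a + e) * (p + f) ≡ (a * (p + f) + (a + e) * p) + e * f
    identity = solve-∀

  rearrangement-≤ : ∀ a b j → a * b ^ j + b * a ^ j ≤ a * a ^ j + b * b ^ j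
  rearrangement-≤ a b j with ≤-total a b
  ... | inj₁ a≤b = rearrangement-≤-ordered a b j a≤b
  ... | inj₂ b≤a = subst₂ _≤_ (+-comm (b * a ^ j) (a * b ^ j)) (+-comm (b * b ^ j) (a * a ^ j))
                             (rearrangement-≤-ordered b a j b≤a)

  module _ {A : Set} where

    chebyshev-sum-≤ : ∀ (xs : List A) (y : A → ℕ) j →
      ∑ xs y * ∑ xs (λ x → y x ^ j) ≤ length xs * ∑ xs (λ x → y x ^ suc j)
    chebyshev-sum-≤ xs y j = *-cancelˡ-≤ 2 (begin
        2 * (P * Q)
      ≡⟨ double P Q ⟩
        P * Q + Q * P
      ≡⟨ cong₂ _+_ (∑-*ʳ xs Q y) (∑-*ʳ xs P (λ x → y x ^ j)) ⟨
        ∑ xs (λ x → y x * Q) + ∑ xs (λ x → y x ^ j * P)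
      ≡⟨ cong₂ _+_ (∑-cong xs (λ x _ → ∑-*ˡ xs (y x) (λ z → y z ^ j)))
                   (∑-cong xs (λ x _ → ∑-*ˡ xs (y x ^ j) y)) ⟨
        ∑ xs (λ x → ∑ xs (λ z → y x * y z ^ j)) + ∑ xs (λ x → ∑ xs (λ z → y x ^ j * y z))
      ≡⟨ ∑-distrib-+ xs (λ x → ∑ xs (λ z → y x * y z ^ j)) (λ x → ∑ xs (λ z → y x ^ j * y z)) ⟨
        ∑ xs (λ x → ∑ xs (λ z → y x * y z ^ j) + ∑ xs (λ z → y x ^ j * y z))
      ≡⟨ ∑-cong xs (λ x _ → ∑-distrib-+ xs (λ z → y x * y z ^ j) (λ z → y x ^ j * y z)) ⟨
        ∑ xs (λ x → ∑ xs (λ z → y x * y z ^ j + y x ^ j * y z))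
      ≤⟨ ∑-mono-≤ xs (λ x _ → ∑-mono-≤ xs (λ z _ →
           subst (λ w → y x * y z ^ j + w ≤ y x * y x ^ j + y z * y z ^ j)
                 (*-comm (y z) (y x ^ j)) (rearrangement-≤ (y x) (y z) j))) ⟩
        ∑ xs (λ x → ∑ xs (λ z → y x ^ suc j + y z ^ suc j))
      ≡⟨ trans (∑-cong xs (λ x _ → ∑-distrib-+ xs (λ _ → y x ^ suc j) (λ z → y z ^ suc j)))
                 (∑-distrib-+ xs (λ x → ∑ xs (λ _ → y x ^ suc j)) (λ _ → R)) ⟩
        ∑ xs (λ x → ∑ xs (λ z → y x ^ suc j)) + ∑ xs (λ x → R)
      ≡⟨ cong₂ _+_ (trans (∑-cong xs (λ x _ → ∑-const xs (y x ^ suc j))) (∑-*ˡ xs L (λ x → y x ^ suc j)))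
                   (∑-const xs R) ⟩
        L * R + L * R
      ≡⟨ cong (L * R +_) (+-identityʳ (L * R)) ⟨
        2 * (L * R) ∎)
      where
      open ≤-Reasoning
      P = ∑ xs y
      Q = ∑ xs (λ x → y x ^ j)
      R = ∑ xs (λ x → y x ^ suc j)
      L = length xs
      double : ∀ p q → 2 * (p * q) ≡ p * q + q * p
      double = solve-∀

    power-mean-≤ : ∀ (xs : List A) (y : A → ℕ) j →
      ∑ xs y ^ suc j ≤ length xs ^ j * ∑ xs (λ x → y x ^ suc j)
    power-mean-≤ xs y zero = ≤-reflexive (trans (*-identityʳ _)
      (trans (∑-cong xs (λ x _ → sym (*-identityʳ (y x)))) (sym (+-identityʳ _))))
    power-mean-≤ xs y (suc j) = begin
        P * P ^ suc j
      ≤⟨ *-monoʳ-≤ P (power-mean-≤ xs y j) ⟩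
        P * (L ^ j * ∑ xs (λ x → y x ^ suc j))
      ≡⟨ x*[y*z]≡y*[x*z] P (L ^ j) _ ⟩
        L ^ j * (P * ∑ xs (λ x → y x ^ suc j))
      ≤⟨ *-monoʳ-≤ (L ^ j) (chebyshev-sum-≤ xs y (suc j)) ⟩
        L ^ j * (L * ∑ xs (λ x → y x ^ suc (suc j)))
      ≡⟨ x*[y*z]≡y*x*z (L ^ j) L _ ⟩
        L * L ^ j * ∑ xs (λ x → y x ^ suc (suc j)) ∎
      where
      open ≤-Reasoning
      P = ∑ xs y
      L = length xs
      x*[y*z]≡y*[x*z] : ∀ a b c → a * (b * c) ≡ b * (a * c)
      x*[y*z]≡y*[x*z] = solve-∀
      x*[y*z]≡y*x*z : ∀ a b c → a * (b * c) ≡ b * a * c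
      x*[y*z]≡y*x*z = solve-∀
module Approximation where

  open import Data.Nat
  open import Data.Nat.Properties
  open import Data.Product using (∃; _,_; _×_)
  open import Data.Sum using (inj₁; inj₂; _⊎_)
  open import Data.Empty using (⊥-elim)
  open import Relation.Binary.PropositionalEquality
  open import Relation.Nullary using (Dec; yes; no; ¬_)
  open NatPowers

  module _ (P : ℕ → Set) (P? : ∀ x → Dec (P x)) where

    Least : ℕ → Set
    Least a = P a × (∀ x → x < a → ¬ P x)

    least-or-none-below : ∀ N → (∃ Least) ⊎ (∀ x → x < N → ¬ P x)
    least-or-none-below zero = inj₂ (λ _ ())
    least-or-none-below (suc N) with least-or-none-below N
    ... | inj₁ found = inj₁ found
    ... | inj₂ none with P? N
    ...   | yes p = inj₁ (N , p , none)
    ...   | no ¬p = inj₂ none-below-suc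
      where
      none-below-suc : ∀ x → x < suc N → ¬ P x
      none-below-suc x x<sN with m≤n⇒m<n∨m≡n (≤-pred x<sN)
      ... | inj₁ x<N = none x x<N
      ... | inj₂ refl = ¬p

    least-witness : ∀ N → P N → ∃ Least
    least-witness N p with least-or-none-below (suc N)
    ... | inj₁ found = found
    ... | inj₂ none = ⊥-elim (none N ≤-refl p)

  -- The least a with D b^r ≤ a^r M; minimality and a ≥ 2 give a ≤ 2 (a - 1), hence the factor 2^r.
  root-approximation : ∀ r D M b → 1 ≤ r → 1 ≤ D → D ≤ M → M < b →
    ∃ λ a → 1 ≤ a × (D * b ^ r ≤ a ^ r * M) × (a ^ r * M ≤ 2 ^ r * D * b ^ r)
  root-approximation r D M b r≥1 D≥1 D≤M M<b
    with least-witness (λ x → D * b ^ r ≤ x ^ r * M) (λ x → D * b ^ r ≤? x ^ r * M) b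
           (≤-trans (≤-reflexive (*-comm D (b ^ r))) (*-monoʳ-≤ (b ^ r) D≤M))
  ... | a , lower , minimal = a , ≤-trans (s≤s z≤n) a≥2 , lower , upper
    where
    open ≤-Reasoning
    M<Db^r : 1 ^ r * M < D * b ^ r
    M<Db^r = begin-strict
      1 ^ r * M   ≡⟨ trans (cong (_* M) (^-zeroˡ r)) (*-identityˡ M) ⟩
      M           <⟨ M<b ⟩
      b           ≤⟨ m≤m^n b r r≥1 ⟩
      b ^ r       ≤⟨ m≤n*m′ (b ^ r) D D≥1 ⟩
      D * b ^ r   ∎
    two≤ : ∀ x → D * b ^ r ≤ x ^ r * M → 2 ≤ x
    two≤ zero x-ok = ⊥-elim (<⇒≱ (≤-<-trans z≤n M<Db^r) (≤-trans x-ok (≤-reflexive (cong (_* M) (0^n≡0 r r≥1)))))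
      where
      0^n≡0 : ∀ r → 1 ≤ r → 0 ^ r ≡ 0
      0^n≡0 (suc r) _ = refl
    two≤ (suc zero) x-ok = ⊥-elim (<⇒≱ M<Db^r x-ok)
    two≤ (suc (suc _)) _ = s≤s (s≤s z≤n)
    a≥2 : 2 ≤ a
    a≥2 = two≤ a lower
    ≤2*pred : ∀ x → 2 ≤ x → x ≤ 2 * pred x
    ≤2*pred (suc zero) (s≤s ())
    ≤2*pred (suc (suc x)) _ = s≤s (≤-trans (m≤n+m (suc x) x) (≤-reflexive (cong (x +_) (sym (*-identityˡ (suc x))))))
    upper : a ^ r * M ≤ 2 ^ r * D * b ^ r
    upper = begin
      a ^ r * M                    ≤⟨ *-monoˡ-≤ M (^-monoˡ-≤ r (≤2*pred a a≥2)) ⟩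
      (2 * pred a) ^ r * M         ≡⟨ trans (cong (_* M) (^-distrib-* 2 (pred a) r)) (*-assoc (2 ^ r) _ M) ⟩
      2 ^ r * (pred a ^ r * M)     ≤⟨ *-monoʳ-≤ (2 ^ r) (<⇒≤ (≰⇒> (minimal (pred a) (pred-a<a a≥2)))) ⟩
      2 ^ r * (D * b ^ r)          ≡⟨ *-assoc (2 ^ r) D (b ^ r) ⟨
      2 ^ r * D * b ^ r            ∎
      where
      pred-a<a : ∀ {a} → 2 ≤ a → pred a < a
      pred-a<a {suc a} _ = ≤-refl
module MassArithmetic where

  open import Data.Nat
  open import Data.Nat.Properties
  open import Data.Nat.Tactic.RingSolver using (solve-∀)
  open import Relation.Binary.PropositionalEquality
  open import Relation.Nullary using (yes; no)
  open NatPowers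

  *-cancelʳ-≤′ : ∀ x y z → 1 ≤ z → x * z ≤ y * z → x ≤ y
  *-cancelʳ-≤′ x y (suc z) _ = *-cancelʳ-≤ x y (suc z)

  *-cancelˡ-≤′ : ∀ x y z → 1 ≤ z → z * x ≤ z * y → x ≤ y
  *-cancelˡ-≤′ x y z z≥1 le = *-cancelʳ-≤′ x y z z≥1 (subst₂ _≤_ (*-comm z x) (*-comm z y) le)

  scale-identity : ∀ n a k m → n ^ k * (a ^ (k * m) * n ^ m) ≡ n ^ (k + m) * a ^ (k * m)
  scale-identity n a k m rewrite ^-distribˡ-+-* n k m = regroup (n ^ k) (n ^ m) (a ^ (k * m))
    where
    regroup : ∀ x y z → x * (z * y) ≡ x * y * z
    regroup = solve-∀

  scale-+ : ∀ n a k m e →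
    n ^ ((m + e) + k) * a ^ ((m + e) * k) ≡ (n ^ (k + m) * a ^ (k * m)) * (a ^ k * n) ^ e
  scale-+ n a k m e = begin
      n ^ ((m + e) + k) * a ^ ((m + e) * k)
    ≡⟨ cong₂ (λ x y → n ^ x * a ^ y) (exponent m e k) (distrib m e k) ⟩
      n ^ ((k + m) + e) * a ^ (k * m + k * e)
    ≡⟨ cong₂ _*_ (^-distribˡ-+-* n (k + m) e) (trans (^-distribˡ-+-* a (k * m) (k * e))
                                                     (cong (a ^ (k * m) *_) (sym (^-*-assoc a k e)))) ⟩
      n ^ (k + m) * n ^ e * (a ^ (k * m) * (a ^ k) ^ e)
    ≡⟨ regroup (n ^ (k + m)) (n ^ e) (a ^ (k * m)) ((a ^ k) ^ e) ⟩
      (n ^ (k + m) * a ^ (k * m)) * ((a ^ k) ^ e * n ^ e)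
    ≡⟨ cong ((n ^ (k + m) * a ^ (k * m)) *_) (^-distrib-* (a ^ k) n e) ⟨
      (n ^ (k + m) * a ^ (k * m)) * (a ^ k * n) ^ e ∎
    where
    open ≡-Reasoning
    exponent : ∀ m e k → (m + e) + k ≡ (k + m) + e
    exponent = solve-∀
    distrib : ∀ m e k → (m + e) * k ≡ k * m + k * e
    distrib = solve-∀
    regroup : ∀ x y z w → x * y * (z * w) ≡ (x * z) * (w * y)
    regroup = solve-∀

  -- A ≤ A^m, so d^m A c^m ≤ (d A c)^m.
  ^-*-<⇒≤ : ∀ d A c u m → 1 ≤ m → d * A * c < u → d ^ m * (A * c ^ m) ≤ u ^ m
  ^-*-<⇒≤ d A c u m m≥1 lt = begin
      d ^ m * (A * c ^ m)      ≤⟨ *-monoʳ-≤ (d ^ m) (*-monoˡ-≤ (c ^ m) (m≤m^n A m m≥1)) ⟩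
      d ^ m * (A ^ m * c ^ m)  ≡⟨ trans (sym (*-assoc (d ^ m) (A ^ m) (c ^ m))) (cong (_* c ^ m) (sym (^-distrib-* d A m))) ⟩
      (d * A) ^ m * c ^ m      ≡⟨ ^-distrib-* (d * A) c m ⟨
      (d * A * c) ^ m          ≤⟨ ^-monoˡ-≤ m (<⇒≤ lt) ⟩
      u ^ m                    ∎
    where open ≤-Reasoning

  -- Either d Γ c < u, or d ≥ u / (Γ c) and then d^m = d^(m+e) / d^e with d^(m+e) < B bad.
  dichotomy-≤ : ∀ d bad u Γ c B m e → 1 ≤ m → d ^ (m + e) < B * bad →
    d ^ m * (Γ * c ^ m) * u ^ e ≤ u ^ m * u ^ e + Γ * c ^ m * B * bad * (Γ * c) ^ e
  dichotomy-≤ d bad u Γ c B m e m≥1 dense with d * (Γ * c) <? u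
  ... | yes small = ≤-trans (*-monoˡ-≤ (u ^ e) (^-*-<⇒≤ d Γ c u m m≥1 (subst (_< u) (sym (*-assoc d Γ c)) small)))
                            (m≤m+n _ _)
  ... | no large = ≤-trans (begin
        d ^ m * (Γ * c ^ m) * u ^ e
      ≡⟨ rotate (d ^ m) (Γ * c ^ m) (u ^ e) ⟩
        Γ * c ^ m * (d ^ m * u ^ e)
      ≤⟨ *-monoʳ-≤ (Γ * c ^ m) (*-monoʳ-≤ (d ^ m) (^-monoˡ-≤ e (≮⇒≥ large))) ⟩
        Γ * c ^ m * (d ^ m * (d * (Γ * c)) ^ e)
      ≡⟨ cong (λ z → Γ * c ^ m * (d ^ m * z)) (^-distrib-* d (Γ * c) e) ⟩
        Γ * c ^ m * (d ^ m * (d ^ e * (Γ * c) ^ e))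
      ≡⟨ cong (Γ * c ^ m *_) (trans (sym (*-assoc (d ^ m) (d ^ e) _)) (cong (_* (Γ * c) ^ e) (sym (^-distribˡ-+-* d m e)))) ⟩
        Γ * c ^ m * (d ^ (m + e) * (Γ * c) ^ e)
      ≤⟨ *-monoʳ-≤ (Γ * c ^ m) (*-monoˡ-≤ ((Γ * c) ^ e) (<⇒≤ dense)) ⟩
        Γ * c ^ m * (B * bad * (Γ * c) ^ e)
      ≡⟨ reassoc (Γ * c ^ m) B bad ((Γ * c) ^ e) ⟩
        Γ * c ^ m * B * bad * (Γ * c) ^ e ∎) (m≤n+m _ _)
    where
    open ≤-Reasoning
    rotate : ∀ x y z → x * y * z ≡ y * (x * z)
    rotate = solve-∀
    reassoc : ∀ x y z w → x * (y * z * w) ≡ x * y * z * w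
    reassoc = solve-∀

  -- Combines the pointwise bound (H₁) with the inductive bound (H₂) on the bad mass;
  -- the constant G₁ = Γ^(h+1) ≥ Γ^(e+1) absorbs the Γ factors and the 2 in Γ = 2F.
  combine-≤ : ∀ M Γ P U X B Y Q E F G₁ → Γ ≡ 2 * F → E ≡ B * G₁ → 1 ≤ G₁ → 1 ≤ B → 1 ≤ U →
    ∀ Γₑ → Γₑ ≤ G₁ →
    M * Γ * P * U ≤ X * U + B * Γₑ * (Y * P * Q) →
    Y * P * Q * E ≤ X * U →
    F * M * P ≤ X
  combine-≤ M Γ P U X B Y Q E F G₁ refl refl G₁≥1 B≥1 U≥1 Γₑ Γₑ≤G₁ H₁ H₂ =
    *-cancelˡ-≤′ (F * M * P) X 2 (s≤s z≤n) (*-cancelʳ-≤′ (2 * (F * M * P)) (2 * X) (B * G₁ * U) BG₁U≥1 (begin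
        2 * (F * M * P) * (B * G₁ * U)
      ≡⟨ regroup₁ F M P B G₁ U ⟩
        B * G₁ * (M * (2 * F) * P * U)
      ≤⟨ *-monoʳ-≤ (B * G₁) H₁ ⟩
        B * G₁ * (X * U + B * Γₑ * (Y * P * Q))
      ≡⟨ regroup₂ B G₁ X U Γₑ (Y * P * Q) ⟩
        B * G₁ * (X * U) + B * Γₑ * (Y * P * Q * (B * G₁))
      ≤⟨ +-monoʳ-≤ (B * G₁ * (X * U)) (*-mono-≤ (*-monoʳ-≤ B Γₑ≤G₁) H₂) ⟩
        B * G₁ * (X * U) + B * G₁ * (X * U)
      ≡⟨ regroup₃ B G₁ X U ⟩
        2 * X * (B * G₁ * U) ∎))
    where
    open ≤-Reasoning
    BG₁U≥1 : 1 ≤ B * G₁ * U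
    BG₁U≥1 = *-mono-≤ (*-mono-≤ B≥1 G₁≥1) U≥1
    regroup₁ : ∀ F M P B G₁ U → 2 * (F * M * P) * (B * G₁ * U) ≡ B * G₁ * (M * (2 * F) * P * U)
    regroup₁ = solve-∀
    regroup₂ : ∀ B G₁ X U Γₑ W → B * G₁ * (X * U + B * Γₑ * W) ≡ B * G₁ * (X * U) + B * Γₑ * (W * (B * G₁))
    regroup₂ = solve-∀
    regroup₃ : ∀ B G₁ X U → B * G₁ * (X * U) + B * G₁ * (X * U) ≡ 2 * X * (B * G₁ * U)
    regroup₃ = solve-∀
module Rescaling where

  open import Data.Nat
  open import Data.Nat.Properties
  open import Data.Nat.Tactic.RingSolver using (solve-∀)
  open import Relation.Binary.PropositionalEquality
  open NatPowers
  open MassArithmetic using (*-cancelʳ-≤′)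

  -- Taking r-th roots of an inequality whose two sides were multiplied by b^(rk) and
  -- (a^r n^(r+1))^k ≥ (D b^r)^k respectively.
  root-< : ∀ d A b a n D r k → 1 ≤ b →
    d ^ r * (A ^ r * n ^ (suc r * k)) < D ^ k * n ^ r →
    D * b ^ r ≤ a ^ r * n ^ suc r →
    d * A * b ^ k < a ^ k * n
  root-< d A b a n D r k b≥1 small lower = ≰⇒> λ large → <-irrefl refl (contradiction large)
    where
    N = n ^ (suc r * k)
    contradiction : a ^ k * n ≤ d * A * b ^ k → (a ^ k * n) ^ r * N < (a ^ k * n) ^ r * N
    contradiction large = begin-strict
        (a ^ k * n) ^ r * N
      ≤⟨ *-monoˡ-≤ N (^-monoˡ-≤ r large) ⟩
        (d * A * b ^ k) ^ r * N
      ≡⟨ cong (_* N) (trans (^-distrib-* (d * A) (b ^ k) r) (cong (_* (b ^ k) ^ r) (^-distrib-* d A r))) ⟩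
        d ^ r * A ^ r * (b ^ k) ^ r * N
      ≡⟨ regroup₁ (d ^ r) (A ^ r) ((b ^ k) ^ r) N ⟩
        d ^ r * (A ^ r * N) * (b ^ k) ^ r
      <⟨ *-monoˡ-< ((b ^ k) ^ r) {{>-nonZero (1≤m^n (b ^ k) r (1≤m^n b k b≥1))}} small ⟩
        D ^ k * n ^ r * (b ^ k) ^ r
      ≡⟨ trans (cong (D ^ k * n ^ r *_) (sym (^-comm b r k)))
               (trans (regroup₂ (D ^ k) (n ^ r) ((b ^ r) ^ k)) (cong (_* n ^ r) (sym (^-distrib-* D (b ^ r) k)))) ⟩
        (D * b ^ r) ^ k * n ^ r
      ≤⟨ *-monoˡ-≤ (n ^ r) (^-monoˡ-≤ k lower) ⟩
        (a ^ r * n ^ suc r) ^ k * n ^ r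
      ≡⟨ cong (_* n ^ r) (trans (^-distrib-* (a ^ r) (n ^ suc r) k) (cong₂ _*_ (^-comm a r k) (^-*-assoc n (suc r) k))) ⟩
        (a ^ k) ^ r * N * n ^ r
      ≡⟨ trans (regroup₂ ((a ^ k) ^ r) N (n ^ r)) (cong (_* N) (sym (^-distrib-* (a ^ k) n r))) ⟩
        (a ^ k * n) ^ r * N ∎
      where
      open ≤-Reasoning
      regroup₁ : ∀ x y z w → x * y * z * w ≡ x * (y * w) * z
      regroup₁ = solve-∀
      regroup₂ : ∀ x y z → x * y * z ≡ x * z * y
      regroup₂ = solve-∀

  noRepMass-rescaled : ∀ n D r j M → D ^ suc j ≤ 2 ^ suc j * (n ^ r) ^ j * M →
    n ^ (suc j + r) * D ^ suc j ≤ 2 ^ suc j * M * n ^ (suc r * suc j)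
  noRepMass-rescaled n D r j M bound = begin
      n ^ (suc j + r) * D ^ suc j
    ≤⟨ *-monoʳ-≤ (n ^ (suc j + r)) bound ⟩
      n ^ (suc j + r) * (2 ^ suc j * (n ^ r) ^ j * M)
    ≡⟨ regroup (n ^ (suc j + r)) (2 ^ suc j) ((n ^ r) ^ j) M ⟩
      2 ^ suc j * M * (n ^ (suc j + r) * (n ^ r) ^ j)
    ≡⟨ cong (2 ^ suc j * M *_) (trans (cong (n ^ (suc j + r) *_) (^-*-assoc n r j))
         (trans (sym (^-distribˡ-+-* n (suc j + r) (r * j))) (cong (n ^_) (exponent r j)))) ⟩
      2 ^ suc j * M * n ^ (suc r * suc j) ∎
    where
    open ≤-Reasoning
    regroup : ∀ x y z w → x * (y * z * w) ≡ y * w * (x * z)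
    regroup = solve-∀
    exponent : ∀ r j → suc j + r + r * j ≡ suc r * suc j
    exponent = solve-∀

  badMass-rescaled : ∀ M B b a n D j r h → 1 ≤ b → j ≤ h →
    M * b ^ (j * r) * (2 ^ (h * r) * B) ≤ n ^ (j + r) * a ^ (j * r) →
    a ^ r * n ^ suc r ≤ 2 ^ r * D * b ^ r →
    M * B * n ^ (suc r * j) ≤ n ^ (j + r) * D ^ j
  badMass-rescaled M B b a n D j r h b≥1 j≤h bound upper =
    *-cancelʳ-≤′ (M * B * N) (n ^ (j + r) * D ^ j) K K≥1 (begin
        M * B * N * K
      ≡⟨ regroup₁ M B N (2 ^ (h * r)) (b ^ (j * r)) ⟩
        M * b ^ (j * r) * (2 ^ (h * r) * B) * N
      ≤⟨ *-monoˡ-≤ N bound ⟩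
        n ^ (j + r) * a ^ (j * r) * N
      ≡⟨ trans (*-assoc (n ^ (j + r)) _ N) (cong (n ^ (j + r) *_) a^jr*N) ⟩
        n ^ (j + r) * (a ^ r * n ^ suc r) ^ j
      ≤⟨ *-monoʳ-≤ (n ^ (j + r)) (^-monoˡ-≤ j upper) ⟩
        n ^ (j + r) * (2 ^ r * D * b ^ r) ^ j
      ≡⟨ cong (n ^ (j + r) *_) (trans (^-distrib-* (2 ^ r * D) (b ^ r) j)
           (cong₂ _*_ (^-distrib-* (2 ^ r) D j) (trans (^-*-assoc b r j) (cong (b ^_) (*-comm r j))))) ⟩
        n ^ (j + r) * ((2 ^ r) ^ j * D ^ j * b ^ (j * r))
      ≤⟨ *-monoʳ-≤ (n ^ (j + r)) (*-monoˡ-≤ (b ^ (j * r)) (*-monoˡ-≤ (D ^ j) 2^rj≤2^hr)) ⟩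
        n ^ (j + r) * (2 ^ (h * r) * D ^ j * b ^ (j * r))
      ≡⟨ regroup₂ (n ^ (j + r)) (2 ^ (h * r)) (D ^ j) (b ^ (j * r)) ⟩
        n ^ (j + r) * D ^ j * K ∎)
    where
    open ≤-Reasoning
    N = n ^ (suc r * j)
    K = 2 ^ (h * r) * b ^ (j * r)
    K≥1 : 1 ≤ K
    K≥1 = *-mono-≤ (1≤m^n 2 (h * r) (s≤s z≤n)) (1≤m^n b (j * r) b≥1)
    regroup₁ : ∀ x y z u v → x * y * z * (u * v) ≡ x * v * (u * y) * z
    regroup₁ = solve-∀
    regroup₂ : ∀ x y z w → x * (y * z * w) ≡ x * z * (y * w)
    regroup₂ = solve-∀
    a^jr*N : a ^ (j * r) * N ≡ (a ^ r * n ^ suc r) ^ j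
    a^jr*N = trans (cong₂ _*_ (trans (cong (a ^_) (*-comm j r)) (sym (^-*-assoc a r j))) (sym (^-*-assoc n (suc r) j)))
                   (sym (^-distrib-* (a ^ r) (n ^ suc r) j))
    2^rj≤2^hr : (2 ^ r) ^ j ≤ 2 ^ (h * r)
    2^rj≤2^hr = subst (_≤ 2 ^ (h * r)) (sym (^-*-assoc 2 r j))
      (^-monoʳ-≤′ 2 (s≤s z≤n) (subst (_≤ h * r) (*-comm j r) (*-monoˡ-≤ r j≤h)))
module NatToRational where

  open import Data.Nat as ℕ using (ℕ; zero; suc; z≤n; s≤s)
  import Data.Nat.Properties as ℕ
  open import Data.Integer as ℤ using (+_; +[1+_]; -[1+_])
  import Data.Integer.Properties as ℤ
  open import Data.Rational using (mkℚ; _≤_; _<_; _+_; _*_; 0ℚ; 1ℚ; *≤*; *<*; ↧ₙ_; _≤ᵇ_; positive; nonNegative; toℚᵘ)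
  open import Data.Rational.Properties
  import Data.Rational.Unnormalised as U
  import Data.Rational.Unnormalised.Properties as U
  open import Data.Nat.Coprimality as Coprime using ()
  open import Data.Bool using (false; T)
  open import Data.Empty using (⊥-elim)
  open import Data.Maybe using (Maybe; just; nothing)
  open import Tactic.RingSolver using (solve-∀)
  open import Tactic.RingSolver.Core.AlmostCommutativeRing using (AlmostCommutativeRing; fromCommutativeRing)
  open import Relation.Binary.PropositionalEquality
  open import Relation.Nullary using (yes; no)

  ℚ-ring : AlmostCommutativeRing _ _
  ℚ-ring = fromCommutativeRing +-*-commutativeRing isZero
    where
    isZero : ∀ x → Maybe (0ℚ ≡ x)
    isZero x with 0ℚ ≟ x
    ... | yes 0≡x = just 0≡x
    ... | no _ = nothing

  ℕ→ℚ≡mkℚ : ∀ x → ℕ→ℚ x ≡ mkℚ (+ x) 0 (Coprime.sym (Coprime.1-coprimeTo x))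
  ℕ→ℚ≡mkℚ x = normalize-coprime (Coprime.sym (Coprime.1-coprimeTo x))

  ℕ→ℚ-mono-≤ : ∀ {x y} → x ℕ.≤ y → ℕ→ℚ x ≤ ℕ→ℚ y
  ℕ→ℚ-mono-≤ {x} {y} x≤y rewrite ℕ→ℚ≡mkℚ x | ℕ→ℚ≡mkℚ y =
    *≤* (subst₂ ℤ._≤_ (sym (ℤ.*-identityʳ (+ x))) (sym (ℤ.*-identityʳ (+ y))) (ℤ.+≤+ x≤y))

  ℕ→ℚ-mono-< : ∀ {x y} → x ℕ.< y → ℕ→ℚ x < ℕ→ℚ y
  ℕ→ℚ-mono-< {x} {y} x<y rewrite ℕ→ℚ≡mkℚ x | ℕ→ℚ≡mkℚ y =
    *<* (subst₂ ℤ._<_ (sym (ℤ.*-identityʳ (+ x))) (sym (ℤ.*-identityʳ (+ y))) (ℤ.+<+ x<y))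

  ℕ→ℚ-cancel-< : ∀ {x y} → ℕ→ℚ x < ℕ→ℚ y → x ℕ.< y
  ℕ→ℚ-cancel-< {x} {y} x<y rewrite ℕ→ℚ≡mkℚ x | ℕ→ℚ≡mkℚ y with x<y
  ... | *<* p = ℤ.drop‿+<+ (subst₂ ℤ._<_ (ℤ.*-identityʳ (+ x)) (ℤ.*-identityʳ (+ y)) p)

  ℕ→ℚ-* : ∀ x y → ℕ→ℚ (x ℕ.* y) ≡ ℕ→ℚ x * ℕ→ℚ y
  ℕ→ℚ-* x y rewrite ℕ→ℚ≡mkℚ x | ℕ→ℚ≡mkℚ y = cong (Data.Rational._/ 1) (ℤ.pos-* x y)

  ℕ→ℚ-*-cancel-< : ∀ {x c y} → ℕ→ℚ x * ℕ→ℚ c < ℕ→ℚ y → x ℕ.* c ℕ.< y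
  ℕ→ℚ-*-cancel-< {x} {c} lt = ℕ→ℚ-cancel-< (subst (_< _) (sym (ℕ→ℚ-* x c)) lt)

  ℕ→ℚ-+ : ∀ x y → ℕ→ℚ (x ℕ.+ y) ≡ ℕ→ℚ x + ℕ→ℚ y
  ℕ→ℚ-+ x y rewrite ℕ→ℚ≡mkℚ x | ℕ→ℚ≡mkℚ y =
    cong (Data.Rational._/ 1) (sym (trans (cong₂ ℤ._+_ (ℤ.*-identityʳ (+ x)) (ℤ.*-identityʳ (+ y))) (sym (ℤ.pos-+ x y))))

  ℕ→ℚ-^ : ∀ x k → ℕ→ℚ (x ℕ.^ k) ≡ ℕ→ℚ x ^ℚ k
  ℕ→ℚ-^ x zero = refl
  ℕ→ℚ-^ x (suc k) = trans (ℕ→ℚ-* x (x ℕ.^ k)) (cong (ℕ→ℚ x *_) (ℕ→ℚ-^ x k))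

  0≤ℕ→ℚ : ∀ x → 0ℚ ≤ ℕ→ℚ x
  0≤ℕ→ℚ x = ℕ→ℚ-mono-≤ {0} {x} z≤n

  0<ℕ→ℚ : ∀ x → 1 ℕ.≤ x → 0ℚ < ℕ→ℚ x
  0<ℕ→ℚ x x≥1 = ℕ→ℚ-mono-< {0} {x} x≥1

  divℕ-*-ℕ→ℚ : ∀ x m → 1 ℕ.≤ m → divℕ x m * ℕ→ℚ m ≡ ℕ→ℚ x
  divℕ-*-ℕ→ℚ x (suc m) _ = toℚᵘ-injective (U.≃-trans (toℚᵘ-homo-* (divℕ x (suc m)) (ℕ→ℚ (suc m)))
      (U.≃-trans (U.*-cong (toℚᵘ-fromℚᵘ (U.mkℚᵘ (+ x) m)) (U.≃-reflexive (cong toℚᵘ (ℕ→ℚ≡mkℚ (suc m)))))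
        (U.≃-trans (U.*≡* cross) (U.≃-reflexive (cong toℚᵘ (sym (ℕ→ℚ≡mkℚ x)))))))
    where
    cross : (+ x ℤ.* + suc m) ℤ.* + 1 ≡ + x ℤ.* (+ suc (m ℕ.* 1))
    cross = trans (ℤ.*-identityʳ (+ x ℤ.* + suc m)) (cong (λ z → + x ℤ.* + suc z) (sym (ℕ.*-identityʳ m)))

  divℕ-1-*-cancel : ∀ m x → 1 ℕ.≤ m → divℕ 1 m * (ℕ→ℚ m * x) ≡ x
  divℕ-1-*-cancel m x m≥1 = trans (assoc (divℕ 1 m) (ℕ→ℚ m) x)
                                  (trans (cong (_* x) (divℕ-*-ℕ→ℚ 1 m m≥1)) (*-identityˡ x))
    where
    assoc : ∀ x y z → x * (y * z) ≡ (x * y) * z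
    assoc = solve-∀ ℚ-ring

  ℕ→ℚ<*ℕ→ℚ⇒1≤ : ∀ x q m → ℕ→ℚ x < q * ℕ→ℚ m → 1 ℕ.≤ m
  ℕ→ℚ<*ℕ→ℚ⇒1≤ x q zero x<q*0 = ⊥-elim (ℕ.n≮0 (ℕ→ℚ-cancel-< {x} {0} (subst (ℕ→ℚ x <_) (*-zeroʳ q) x<q*0)))
  ℕ→ℚ<*ℕ→ℚ⇒1≤ x q (suc m) _ = s≤s z≤n

  0<divℕ-1 : ∀ m → 1 ℕ.≤ m → 0ℚ < divℕ 1 m
  0<divℕ-1 m m≥1 = ≰⇒> λ 1/m≤0 → <-irrefl refl (<-≤-trans (ℕ→ℚ-mono-< {0} {1} (s≤s z≤n))
    (subst₂ _≤_ (divℕ-*-ℕ→ℚ 1 m m≥1) (*-zeroˡ (ℕ→ℚ m)) (*-monoʳ-≤-nonNeg (ℕ→ℚ m) {{nonNegative (0≤ℕ→ℚ m)}} 1/m≤0)))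

  -- 1 / denominator ≤ β, since the numerator of a positive β is at least 1.
  divℕ-1-↧ₙ≤ : ∀ β → 0ℚ < β → divℕ 1 (↧ₙ β) ≤ β
  divℕ-1-↧ₙ≤ (mkℚ +[1+ p ] d coprime) _ =
    *-cancelʳ-≤-pos (ℕ→ℚ (suc d)) {{positive (0<ℕ→ℚ (suc d) (s≤s z≤n))}}
      (subst₂ _≤_ (sym (divℕ-*-ℕ→ℚ 1 (suc d) (s≤s z≤n)))
                  (sym (trans (cong (_* ℕ→ℚ (suc d)) (sym (normalize-coprime coprime))) (divℕ-*-ℕ→ℚ (suc p) (suc d) (s≤s z≤n))))
        (ℕ→ℚ-mono-≤ {1} {suc p} (s≤s z≤n)))
  divℕ-1-↧ₙ≤ (mkℚ (+ zero) d c) β>0 with positive β>0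
  ... | ()
  divℕ-1-↧ₙ≤ (mkℚ -[1+ p ] d c) β>0 with positive β>0
  ... | ()

  ^ℚ-distrib-* : ∀ x y k → (x * y) ^ℚ k ≡ x ^ℚ k * y ^ℚ k
  ^ℚ-distrib-* x y zero = refl
  ^ℚ-distrib-* x y (suc k) rewrite ^ℚ-distrib-* x y k = interchange x y (x ^ℚ k) (y ^ℚ k)
    where
    interchange : ∀ x y p q → x * y * (p * q) ≡ x * p * (y * q)
    interchange = solve-∀ ℚ-ring

  1^ℚ : ∀ k → 1ℚ ^ℚ k ≡ 1ℚ
  1^ℚ zero = refl
  1^ℚ (suc k) rewrite 1^ℚ k = refl

  ≤ᵇ≡false⇒> : ∀ {p q} → (p ≤ᵇ q) ≡ false → q < p
  ≤ᵇ≡false⇒> p≤ᵇq≡false = ≰⇒> (λ p≤q → subst T p≤ᵇq≡false (≤⇒≤ᵇ p≤q))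
module Counting {n : ℕ} (G : Graph n) where

  open import Data.Bool using (Bool; true; false; _∧_; not)
  open import Data.Nat
  open import Data.Nat.Properties
  open import Data.Fin using (Fin)
  open import Data.List using (List; []; _∷_; length; map; allFin)
  open import Data.List.Properties using (length-tabulate)
  open import Data.Bool.ListAction using (all)
  open import Relation.Binary.PropositionalEquality
  open Sums

  V : List (Fin n)
  V = allFin n

  length-V : length V ≡ n
  length-V = length-tabulate (λ v → v)

  count≡∑𝕀 : ∀ {A : Set} (P : A → Bool) xs → count G P xs ≡ ∑ xs (λ x → 𝕀 (P x))
  count≡∑𝕀 P [] = refl
  count≡∑𝕀 P (x ∷ xs) with P x
  ... | true = cong suc (count≡∑𝕀 P xs)
  ... | false = count≡∑𝕀 P xs

  ∑-seqs-suc : ∀ k (f : List (Fin n) → ℕ) →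
    ∑ (seqs G (suc k)) f ≡ ∑ V (λ v → ∑ (seqs G k) (λ S → f (v ∷ S)))
  ∑-seqs-suc k f = trans (∑-concatMap (λ v → map (v ∷_) (seqs G k)) V f)
                         (∑-cong V (λ v _ → ∑-map (v ∷_) (seqs G k) f))

  ∑-seqs-mono-≤ : ∀ k {f g : List (Fin n) → ℕ} → (∀ T → length T ≡ k → f T ≤ g T) →
    ∑ (seqs G k) f ≤ ∑ (seqs G k) g
  ∑-seqs-mono-≤ zero f≤g = +-monoˡ-≤ 0 (f≤g [] refl)
  ∑-seqs-mono-≤ (suc k) {f} {g} f≤g = subst₂ _≤_ (sym (∑-seqs-suc k f)) (sym (∑-seqs-suc k g))
    (∑-mono-≤ V (λ v _ → ∑-seqs-mono-≤ k (λ T |T|≡k → f≤g (v ∷ T) (cong suc |T|≡k))))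

  ∑-seqs-all : ∀ k (A : Fin n → Bool) → ∑ (seqs G k) (λ T → 𝕀 (all A T)) ≡ ∑ V (λ v → 𝕀 (A v)) ^ k
  ∑-seqs-all zero A = refl
  ∑-seqs-all (suc k) A = begin
      ∑ (seqs G (suc k)) (λ T → 𝕀 (all A T))
    ≡⟨ ∑-seqs-suc k (λ T → 𝕀 (all A T)) ⟩
      ∑ V (λ v → ∑ (seqs G k) (λ S → 𝕀 (A v ∧ all A S)))
    ≡⟨ ∑-cong V (λ v _ → trans (∑-cong (seqs G k) (λ S _ → 𝕀-∧ (A v) (all A S)))
                               (∑-*ˡ (seqs G k) (𝕀 (A v)) (λ S → 𝕀 (all A S)))) ⟩
      ∑ V (λ v → 𝕀 (A v) * ∑ (seqs G k) (λ S → 𝕀 (all A S)))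
    ≡⟨ ∑-*ʳ V _ (λ v → 𝕀 (A v)) ⟩
      ∑ V (λ v → 𝕀 (A v)) * ∑ (seqs G k) (λ S → 𝕀 (all A S))
    ≡⟨ cong (∑ V (λ v → 𝕀 (A v)) *_) (∑-seqs-all k A) ⟩
      ∑ V (λ v → 𝕀 (A v)) * ∑ V (λ v → 𝕀 (A v)) ^ k ∎
    where open ≡-Reasoning

  all-const-true : ∀ (S : List (Fin n)) → all (λ _ → true) S ≡ true
  all-const-true [] = refl
  all-const-true (x ∷ S) = all-const-true S

  ∑-seqs-1 : ∀ k → ∑ (seqs G k) (λ _ → 1) ≡ n ^ k
  ∑-seqs-1 k = begin
      ∑ (seqs G k) (λ _ → 1)                   ≡⟨ ∑-cong (seqs G k) (λ T _ → cong 𝕀 (sym (all-const-true T))) ⟩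
      ∑ (seqs G k) (λ T → 𝕀 (all (λ _ → true) T)) ≡⟨ ∑-seqs-all k (λ _ → true) ⟩
      ∑ V (λ _ → 1) ^ k                        ≡⟨ cong (_^ k) (trans (∑-const V 1) (trans (*-identityʳ _) length-V)) ⟩
      n ^ k ∎
    where open ≡-Reasoning

  length-seqs : ∀ k → length (seqs G k) ≡ n ^ k
  length-seqs k = trans (sym (*-identityʳ _)) (trans (sym (∑-const (seqs G k) 1)) (∑-seqs-1 k))

  ∑-seqs-≤ : ∀ k c (f : List (Fin n) → ℕ) → (∀ T → length T ≡ k → f T ≤ c) → ∑ (seqs G k) f ≤ n ^ k * c
  ∑-seqs-≤ k c f f≤c = begin
      ∑ (seqs G k) f                  ≤⟨ ∑-seqs-mono-≤ k f≤c ⟩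
      ∑ (seqs G k) (λ _ → c)          ≡⟨ ∑-const (seqs G k) c ⟩
      length (seqs G k) * c           ≡⟨ cong (_* c) (length-seqs k) ⟩
      n ^ k * c ∎
    where open ≤-Reasoning

  nbhd≡∑ : ∀ S → nbhd G S ≡ ∑ V (λ v → 𝕀 (inN G S v))
  nbhd≡∑ S = count≡∑𝕀 (inN G S) V

  nbhd-^≡∑ : ∀ S k → nbhd G S ^ k ≡ ∑ (seqs G k) (λ T → 𝕀 (all (inN G S) T))
  nbhd-^≡∑ S k = sym (trans (∑-seqs-all k (inN G S)) (cong (_^ k) (sym (nbhd≡∑ S))))

  all-∧ : ∀ (P Q : Fin n → Bool) S → all (λ s → P s ∧ Q s) S ≡ all P S ∧ all Q S
  all-∧ P Q [] = refl
  all-∧ P Q (x ∷ S) rewrite all-∧ P Q S with P x | Q x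
  ... | true | true = refl
  ... | true | false with all P S
  ...   | true = refl
  ...   | false = refl
  all-∧ P Q (x ∷ S) | false | _ = refl

  all-comm : ∀ (R : Fin n → Fin n → Bool) S T →
    all (λ t → all (λ s → R s t) S) T ≡ all (λ s → all (λ t → R s t) T) S
  all-comm R S [] = sym (all-const-true S)
  all-comm R S (t ∷ T) rewrite all-comm R S T = sym (all-∧ (λ s → R s t) (λ s → all (λ t → R s t) T) S)

  all-cong : ∀ {P Q : Fin n → Bool} S → (∀ x → P x ≡ Q x) → all P S ≡ all Q S
  all-cong [] P≡Q = refl
  all-cong (x ∷ S) P≡Q = cong₂ _∧_ (P≡Q x) (all-cong S P≡Q)

  inN-sym : ∀ S T → all (inN G S) T ≡ all (inN G T) S
  inN-sym S T = trans (all-comm (adj G) S T) (all-cong S (λ s → all-cong T (λ t → Graph.sym G s t)))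

  deg≡∑ : ∀ v → deg G v ≡ ∑ V (λ s → 𝕀 (adj G s v))
  deg≡∑ v = trans (count≡∑𝕀 (adj G v) V) (∑-cong V (λ s _ → cong 𝕀 (Graph.sym G v s)))

  deg≤n : ∀ v → deg G v ≤ n
  deg≤n v = begin
    deg G v                     ≡⟨ count≡∑𝕀 (adj G v) V ⟩
    ∑ V (λ s → 𝕀 (adj G v s))   ≤⟨ ∑-≤-length* V 1 _ (λ s _ → 𝕀≤1 (adj G v s)) ⟩
    length V * 1                ≡⟨ trans (*-identityʳ _) length-V ⟩
    n ∎
    where open ≤-Reasoning

  ∑-nbhd≡∑-deg^ : ∀ r → ∑ (seqs G r) (nbhd G) ≡ ∑ V (λ v → deg G v ^ r)
  ∑-nbhd≡∑-deg^ r = begin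
      ∑ (seqs G r) (nbhd G)
    ≡⟨ ∑-cong (seqs G r) (λ T _ → nbhd≡∑ T) ⟩
      ∑ (seqs G r) (λ T → ∑ V (λ v → 𝕀 (all (λ s → adj G s v) T)))
    ≡⟨ ∑-comm (seqs G r) V (λ T v → 𝕀 (all (λ s → adj G s v) T)) ⟩
      ∑ V (λ v → ∑ (seqs G r) (λ T → 𝕀 (all (λ s → adj G s v) T)))
    ≡⟨ ∑-cong V (λ v _ → trans (∑-seqs-all r (λ s → adj G s v)) (cong (_^ r) (sym (deg≡∑ v)))) ⟩
      ∑ V (λ v → deg G v ^ r) ∎
    where open ≡-Reasoning

  ∑-deg^≤ : ∀ r → ∑ V (λ v → deg G v ^ r) ≤ n ^ suc r
  ∑-deg^≤ r = begin
    ∑ V (λ v → deg G v ^ r)   ≤⟨ ∑-≤-length* V (n ^ r) _ (λ v _ → ^-monoˡ-≤ r (deg≤n v)) ⟩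
    length V * n ^ r          ≡⟨ cong (_* n ^ r) length-V ⟩
    n ^ suc r ∎
    where open ≤-Reasoning

  ∑-∑-inN≡∑-nbhd^ : ∀ k k′ (g : List (Fin n) → ℕ) →
    ∑ (seqs G k) (λ S → ∑ (seqs G k′) (λ T → 𝕀 (all (inN G S) T) * g T))
      ≡ ∑ (seqs G k′) (λ T → nbhd G T ^ k * g T)
  ∑-∑-inN≡∑-nbhd^ k k′ g = begin
      ∑ (seqs G k) (λ S → ∑ (seqs G k′) (λ T → 𝕀 (all (inN G S) T) * g T))
    ≡⟨ ∑-comm (seqs G k) (seqs G k′) (λ S T → 𝕀 (all (inN G S) T) * g T) ⟩
      ∑ (seqs G k′) (λ T → ∑ (seqs G k) (λ S → 𝕀 (all (inN G S) T) * g T))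
    ≡⟨ ∑-cong (seqs G k′) (λ T _ → trans (∑-*ʳ (seqs G k) (g T) (λ S → 𝕀 (all (inN G S) T)))
         (cong (_* g T) (trans (∑-cong (seqs G k) (λ S _ → cong 𝕀 (inN-sym S T))) (sym (nbhd-^≡∑ T k))))) ⟩
      ∑ (seqs G k′) (λ T → nbhd G T ^ k * g T) ∎
    where open ≡-Reasoning

  count-∧+count-∧-not : ∀ (P : List (Fin n) → Bool) S k →
    count G (λ T → all (inN G S) T ∧ P T) (seqs G k) + count G (λ T → all (inN G S) T ∧ not (P T)) (seqs G k)
      ≡ nbhd G S ^ k
  count-∧+count-∧-not P S k = begin
      count G (λ T → all (inN G S) T ∧ P T) (seqs G k) + count G (λ T → all (inN G S) T ∧ not (P T)) (seqs G k)
    ≡⟨ cong₂ _+_ (count≡∑𝕀 _ (seqs G k)) (count≡∑𝕀 _ (seqs G k)) ⟩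
      ∑ (seqs G k) (λ T → 𝕀 (all (inN G S) T ∧ P T)) + ∑ (seqs G k) (λ T → 𝕀 (all (inN G S) T ∧ not (P T)))
    ≡⟨ ∑-distrib-+ (seqs G k) (λ T → 𝕀 (all (inN G S) T ∧ P T)) (λ T → 𝕀 (all (inN G S) T ∧ not (P T))) ⟨
      ∑ (seqs G k) (λ T → 𝕀 (all (inN G S) T ∧ P T) + 𝕀 (all (inN G S) T ∧ not (P T)))
    ≡⟨ ∑-cong (seqs G k) (λ T _ → 𝕀-∧+𝕀-∧-not (all (inN G S) T) (P T)) ⟩
      ∑ (seqs G k) (λ T → 𝕀 (all (inN G S) T))
    ≡⟨ nbhd-^≡∑ S k ⟨
      nbhd G S ^ k ∎
    where
    open ≡-Reasoning
    𝕀-∧+𝕀-∧-not : ∀ a p → 𝕀 (a ∧ p) + 𝕀 (a ∧ not p) ≡ 𝕀 a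
    𝕀-∧+𝕀-∧-not true true = refl
    𝕀-∧+𝕀-∧-not true false = refl
    𝕀-∧+𝕀-∧-not false p = refl
module NoRepetition {n : ℕ} (G : Graph n) where

  open import Data.Bool using (Bool; true; false; _∧_; not)
  open import Data.Nat hiding (_≟_)
  open import Data.Nat.Properties hiding (_≟_; suc-injective)
  open import Data.Fin using (Fin; zero; suc; _≟_)
  open import Data.Fin.Properties using (suc-injective)
  open import Data.List using (List; []; _∷_; length; tabulate)
  open import Data.Bool.ListAction using (all)
  open import Data.Empty using (⊥-elim)
  open import Relation.Binary.PropositionalEquality
  open import Relation.Nullary using (does; yes; no)
  open Sums
  open NatPowers using (^-distrib-*)
  open PowerMean using (power-mean-≤)
  open Counting G

  ∑-tabulate-≟≡0 : ∀ {m} k (g : Fin k → Fin m) (s : Fin m) → (∀ i → g i ≢ s) →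
    ∑ (tabulate g) (λ v → 𝕀 (does (v ≟ s))) ≡ 0
  ∑-tabulate-≟≡0 zero g s g≢s = refl
  ∑-tabulate-≟≡0 (suc k) g s g≢s with g zero ≟ s
  ... | yes g0≡s = ⊥-elim (g≢s zero g0≡s)
  ... | no _ = ∑-tabulate-≟≡0 k (λ i → g (suc i)) s (λ i → g≢s (suc i))

  ∑-tabulate-≟≤1 : ∀ {m} k (g : Fin k → Fin m) (s : Fin m) → (∀ i j → g i ≡ g j → i ≡ j) →
    ∑ (tabulate g) (λ v → 𝕀 (does (v ≟ s))) ≤ 1
  ∑-tabulate-≟≤1 zero g s g-inj = z≤n
  ∑-tabulate-≟≤1 (suc k) g s g-inj with g zero ≟ s
  ... | yes g0≡s = ≤-reflexive (cong suc (∑-tabulate-≟≡0 k (λ i → g (suc i)) s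
                     (λ i gi≡s → zero≢suc (g-inj zero (suc i) (trans g0≡s (sym gi≡s))))))
    where
    zero≢suc : ∀ {i} → Fin.zero {k} ≢ suc i
    zero≢suc ()
  ... | no _ = ∑-tabulate-≟≤1 k (λ i → g (suc i)) s (λ i j e → suc-injective (g-inj (suc i) (suc j) e))

  ∑-≟≤1 : ∀ (s : Fin n) → ∑ V (λ v → 𝕀 (does (v ≟ s))) ≤ 1
  ∑-≟≤1 s = ∑-tabulate-≟≤1 n (λ v → v) s (λ _ _ e → e)

  avoids : Fin n → List (Fin n) → Bool
  avoids v S = all (λ s → not (does (v ≟ s))) S

  ∑∸length≤∑-avoids : ∀ (A : Fin n → Bool) S →
    ∑ V (λ v → 𝕀 (A v)) ∸ length S ≤ ∑ V (λ v → 𝕀 (A v) * 𝕀 (avoids v S))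
  ∑∸length≤∑-avoids A [] = ≤-reflexive (∑-cong V (λ v _ → sym (*-identityʳ (𝕀 (A v)))))
  ∑∸length≤∑-avoids A (s ∷ S) = begin
      ∑ V (λ v → 𝕀 (A v)) ∸ suc (length S)
    ≡⟨ trans (∸-+-assoc (∑ V (λ v → 𝕀 (A v))) (length S) 1) (cong (∑ V (λ v → 𝕀 (A v)) ∸_) (+-comm (length S) 1)) ⟨
      ∑ V (λ v → 𝕀 (A v)) ∸ length S ∸ 1
    ≤⟨ ∸-mono (∑∸length≤∑-avoids A S) (∑-≟≤1 s) ⟩
      ∑ V (λ v → 𝕀 (A v) * 𝕀 (avoids v S)) ∸ ∑ V (λ v → 𝕀 (does (v ≟ s)))
    ≤⟨ ∑-∸ V (λ v → 𝕀 (A v) * 𝕀 (avoids v S)) (λ v → 𝕀 (does (v ≟ s))) ⟩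
      ∑ V (λ v → 𝕀 (A v) * 𝕀 (avoids v S) ∸ 𝕀 (does (v ≟ s)))
    ≤⟨ ∑-mono-≤ V (λ v _ → 𝕀-∸-≤ (A v) (avoids v S) (does (v ≟ s))) ⟩
      ∑ V (λ v → 𝕀 (A v) * 𝕀 (avoids v (s ∷ S))) ∎
    where
    open ≤-Reasoning
    𝕀-∸-≤ : ∀ a b c → 𝕀 a * 𝕀 b ∸ 𝕀 c ≤ 𝕀 a * 𝕀 (not c ∧ b)
    𝕀-∸-≤ false b c = ≤-reflexive (0∸n≡0 (𝕀 c))
    𝕀-∸-≤ true true true = z≤n
    𝕀-∸-≤ true true false = ≤-refl
    𝕀-∸-≤ true false true = z≤n
    𝕀-∸-≤ true false false = z≤n

  -- An injective sequence of length j in a set of size c can be continued in at least c ∸ j ways.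
  [∑∸j]^j≤∑-noRep : ∀ j (A : Fin n → Bool) →
    (∑ V (λ v → 𝕀 (A v)) ∸ j) ^ j ≤ ∑ (seqs G j) (λ S → 𝕀 (noRep G S) * 𝕀 (all A S))
  [∑∸j]^j≤∑-noRep zero A = ≤-refl
  [∑∸j]^j≤∑-noRep (suc j) A = begin
      (c ∸ suc j) ^ suc j
    ≤⟨ *-mono-≤ (∸-monoʳ-≤ c (n≤1+n j)) (^-monoˡ-≤ j (∸-monoʳ-≤ c (n≤1+n j))) ⟩
      (c ∸ j) * (c ∸ j) ^ j
    ≤⟨ *-monoʳ-≤ (c ∸ j) ([∑∸j]^j≤∑-noRep j A) ⟩
      (c ∸ j) * ∑ (seqs G j) (λ S → 𝕀 (noRep G S) * 𝕀 (all A S))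
    ≡⟨ ∑-*ˡ (seqs G j) (c ∸ j) (λ S → 𝕀 (noRep G S) * 𝕀 (all A S)) ⟨
      ∑ (seqs G j) (λ S → (c ∸ j) * (𝕀 (noRep G S) * 𝕀 (all A S)))
    ≤⟨ ∑-seqs-mono-≤ j (λ S |S|≡j → *-monoˡ-≤ _
         (subst (λ l → c ∸ l ≤ ∑ V (λ v → 𝕀 (A v) * 𝕀 (avoids v S))) |S|≡j (∑∸length≤∑-avoids A S))) ⟩
      ∑ (seqs G j) (λ S → ∑ V (λ v → 𝕀 (A v) * 𝕀 (avoids v S)) * (𝕀 (noRep G S) * 𝕀 (all A S)))
    ≡⟨ ∑-cong (seqs G j) (λ S _ → ∑-*ʳ V _ (λ v → 𝕀 (A v) * 𝕀 (avoids v S))) ⟨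
      ∑ (seqs G j) (λ S → ∑ V (λ v → 𝕀 (A v) * 𝕀 (avoids v S) * (𝕀 (noRep G S) * 𝕀 (all A S))))
    ≡⟨ ∑-comm (seqs G j) V _ ⟩
      ∑ V (λ v → ∑ (seqs G j) (λ S → 𝕀 (A v) * 𝕀 (avoids v S) * (𝕀 (noRep G S) * 𝕀 (all A S))))
    ≡⟨ ∑-cong V (λ v _ → ∑-cong (seqs G j) (λ S _ → regroup (A v) (avoids v S) (noRep G S) (all A S))) ⟩
      ∑ V (λ v → ∑ (seqs G j) (λ S → 𝕀 (noRep G (v ∷ S)) * 𝕀 (all A (v ∷ S))))
    ≡⟨ ∑-seqs-suc j (λ S → 𝕀 (noRep G S) * 𝕀 (all A S)) ⟨
      ∑ (seqs G (suc j)) (λ S → 𝕀 (noRep G S) * 𝕀 (all A S)) ∎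
    where
    open ≤-Reasoning
    c = ∑ V (λ v → 𝕀 (A v))
    regroup : ∀ a b x y → 𝕀 a * 𝕀 b * (𝕀 x * 𝕀 y) ≡ 𝕀 (b ∧ x) * 𝕀 (a ∧ y)
    regroup false b x y = sym (*-zeroʳ (𝕀 (b ∧ x)))
    regroup true false x y = refl
    regroup true true false y = refl
    regroup true true true false = refl
    regroup true true true true = refl

  degMoment : ℕ → ℕ
  degMoment r = ∑ V (λ v → deg G v ^ r)

  noRepMass : ℕ → ℕ → ℕ
  noRepMass j r = ∑ (seqs G j) (λ S → 𝕀 (noRep G S) * nbhd G S ^ r)

  ∑-[nbhd∸j]^j≤noRepMass : ∀ j r → ∑ (seqs G r) (λ T → (nbhd G T ∸ j) ^ j) ≤ noRepMass j r
  ∑-[nbhd∸j]^j≤noRepMass j r = begin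
      ∑ (seqs G r) (λ T → (nbhd G T ∸ j) ^ j)
    ≤⟨ ∑-mono-≤ (seqs G r) (λ T _ → subst (λ d → (d ∸ j) ^ j ≤ ∑ (seqs G j) (λ S → 𝕀 (noRep G S) * 𝕀 (all (inN G T) S))) (sym (nbhd≡∑ T)) ([∑∸j]^j≤∑-noRep j (inN G T))) ⟩
      ∑ (seqs G r) (λ T → ∑ (seqs G j) (λ S → 𝕀 (noRep G S) * 𝕀 (all (inN G T) S)))
    ≡⟨ ∑-comm (seqs G r) (seqs G j) _ ⟩
      ∑ (seqs G j) (λ S → ∑ (seqs G r) (λ T → 𝕀 (noRep G S) * 𝕀 (all (inN G T) S)))
    ≡⟨ ∑-cong (seqs G j) (λ S _ → trans (∑-*ˡ (seqs G r) (𝕀 (noRep G S)) (λ T → 𝕀 (all (inN G T) S)))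
         (cong (𝕀 (noRep G S) *_) (trans (∑-cong (seqs G r) (λ T _ → cong 𝕀 (inN-sym T S))) (sym (nbhd-^≡∑ S r))))) ⟩
      noRepMass j r ∎
    where open ≤-Reasoning

  ≤2*[∸] : ∀ {c d} → 2 * c ≤ d → d ≤ 2 * (d ∸ c)
  ≤2*[∸] {c} {d} 2c≤d = begin
      d                   ≡⟨ m∸n+n≡m (≤-trans (m≤m+n c (c + 0)) 2c≤d) ⟨
      (d ∸ c) + c         ≤⟨ +-monoʳ-≤ (d ∸ c) (≤-trans (≤-reflexive (sym (m+n∸n≡m c c)))
                                                  (∸-monoˡ-≤ c (≤-trans (≤-reflexive (cong (c +_) (sym (+-identityʳ c)))) 2c≤d))) ⟩
      (d ∸ c) + (d ∸ c)   ≡⟨ cong ((d ∸ c) +_) (+-identityʳ (d ∸ c)) ⟨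
      2 * (d ∸ c) ∎
    where open ≤-Reasoning

  -- Jensen applied to T ↦ |N(T)| ∸ (j+1) over all r-sequences; the hypothesis makes the
  -- subtracted n^r (j+1) at most half of the degree moment.
  degMoment^≤noRepMass : ∀ j r → 2 * (n ^ r * suc j) ≤ degMoment r →
    degMoment r ^ suc j ≤ 2 ^ suc j * (n ^ r) ^ j * noRepMass (suc j) r
  degMoment^≤noRepMass j r hyp = begin
      D ^ suc j
    ≤⟨ ^-monoˡ-≤ (suc j) (≤2*[∸] {n ^ r * suc j} hyp) ⟩
      (2 * (D ∸ n ^ r * suc j)) ^ suc j
    ≡⟨ ^-distrib-* 2 (D ∸ n ^ r * suc j) (suc j) ⟩
      2 ^ suc j * (D ∸ n ^ r * suc j) ^ suc j
    ≤⟨ *-monoʳ-≤ (2 ^ suc j) (^-monoˡ-≤ (suc j) D∸≤∑) ⟩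
      2 ^ suc j * ∑ (seqs G r) y ^ suc j
    ≤⟨ *-monoʳ-≤ (2 ^ suc j) (power-mean-≤ (seqs G r) y j) ⟩
      2 ^ suc j * (length (seqs G r) ^ j * ∑ (seqs G r) (λ T → y T ^ suc j))
    ≤⟨ *-monoʳ-≤ (2 ^ suc j) (*-mono-≤ (≤-reflexive (cong (_^ j) (length-seqs r))) (∑-[nbhd∸j]^j≤noRepMass (suc j) r)) ⟩
      2 ^ suc j * ((n ^ r) ^ j * noRepMass (suc j) r)
    ≡⟨ *-assoc (2 ^ suc j) _ _ ⟨
      2 ^ suc j * (n ^ r) ^ j * noRepMass (suc j) r ∎
    where
    open ≤-Reasoning
    D = degMoment r
    y : List (Fin n) → ℕ
    y T = nbhd G T ∸ suc j
    D∸≤∑ : D ∸ n ^ r * suc j ≤ ∑ (seqs G r) y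
    D∸≤∑ = begin
        D ∸ n ^ r * suc j
      ≡⟨ cong₂ _∸_ (∑-nbhd≡∑-deg^ r) (trans (∑-const (seqs G r) (suc j)) (cong (_* suc j) (length-seqs r))) ⟨
        ∑ (seqs G r) (nbhd G) ∸ ∑ (seqs G r) (λ _ → suc j)
      ≤⟨ ∑-∸ (seqs G r) (nbhd G) (λ _ → suc j) ⟩
        ∑ (seqs G r) y ∎
module Boost (B h : ℕ) where

  open import Data.Nat
  open import Data.Nat.Properties
  open import Data.Nat.GeneralisedArithmetic using (iterate)
  open import Relation.Binary.PropositionalEquality
  open NatPowers

  boost : ℕ → ℕ
  boost E = B * (2 * (suc (suc h) * E)) ^ suc h

  iterate-+ : ∀ x y E → iterate boost E (x + y) ≡ iterate boost (iterate boost E x) y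
  iterate-+ zero y E = refl
  iterate-+ (suc x) y E = iterate-+ x y (boost E)

  ≤[h+2]* : ∀ E → E ≤ suc (suc h) * E
  ≤[h+2]* E = m≤m+n E _

  module _ (B≥1 : 1 ≤ B) where

    [h+2]*≤boost : ∀ E → suc (suc h) * E ≤ boost E
    [h+2]*≤boost E = begin
        F                    ≤⟨ m≤m+n F (F + 0) ⟩
        2 * F                ≤⟨ m≤m^n (2 * F) (suc h) (s≤s z≤n) ⟩
        (2 * F) ^ suc h      ≤⟨ m≤n*m′ ((2 * F) ^ suc h) B B≥1 ⟩
        B * (2 * F) ^ suc h  ∎
      where
      open ≤-Reasoning
      F = suc (suc h) * E

    ≤iterate : ∀ i E → E ≤ iterate boost E i
    ≤iterate zero E = ≤-refl
    ≤iterate (suc i) E = ≤-trans (≤-trans (≤[h+2]* E) ([h+2]*≤boost E)) (≤iterate i (boost E))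
module BadMass {n : ℕ} (G : Graph n) (α β : ℚ) (h r : ℕ) where

  open import Data.Bool using (Bool; true; false; _∧_; not; T)
  open import Data.Nat hiding (_≟_)
  open import Data.Nat.Properties hiding (_≟_)
  open import Data.Nat.Tactic.RingSolver using (solve-∀)
  open import Data.Nat.GeneralisedArithmetic using (iterate)
  open import Data.Fin using (Fin)
  open import Data.List using (List; []; _∷_; length; upTo)
  open import Data.List.Properties using (length-upTo)
  open import Data.List.Membership.Propositional using (_∈_)
  open import Data.List.Membership.Propositional.Properties using (∈-upTo⁻)
  open import Data.Bool.ListAction using (all)
  open import Data.Empty using (⊥-elim)
  open import Data.Rational as Q using ()
  open import Relation.Binary.PropositionalEquality
  open import Relation.Nullary using (Dec; does; yes; no)
  open Sums
  open NatPowers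
  open MassArithmetic
  open Counting G
  open Goodness G α β h r

  densityHolds : ℕ → List (Fin n) → ℕ → Bool
  densityHolds i S k =
    (Q.1ℚ Q.- β) Q.* (ℕ→ℚ (nbhd G S) ^ℚ k) Q.≤ᵇ ℕ→ℚ (count G (λ T → all (inN G S) T ∧ good i T) (seqs G k))

  badCount : ℕ → List (Fin n) → ℕ → ℕ
  badCount i S k = count G (λ T → all (inN G S) T ∧ not (good i T)) (seqs G k)

  badMass : ℕ → ℕ → ℕ → ℕ
  badMass i k m = ∑ (seqs G k) (λ T → 𝕀 (not (good i T)) * nbhd G T ^ m)

  nonZeroGoodMass : ℕ → ℕ → ℕ
  nonZeroGoodMass k m = ∑ (seqs G k) (λ T → 𝕀 (not (zeroGood T)) * nbhd G T ^ m)

  densityFailMass : ℕ → ℕ → ℕ → ℕ → ℕ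
  densityFailMass i k m k′ = ∑ (seqs G k) (λ T → 𝕀 (not (densityHolds i T k′)) * nbhd G T ^ m)

  𝕀-not-all≤∑ : ∀ (c : ℕ → Bool) ks → 𝕀 (not (all c ks)) ≤ ∑ ks (λ k → 𝕀 (not (c k)))
  𝕀-not-all≤∑ c [] = z≤n
  𝕀-not-all≤∑ c (k ∷ ks) with c k
  ... | true = 𝕀-not-all≤∑ c ks
  ... | false = s≤s z≤n

  𝕀-not-good-suc≤ : ∀ i S → length S ≤ h →
    𝕀 (not (good (suc i) S)) ≤ 𝕀 (not (zeroGood S)) + ∑ (range (length S) h) (λ k → 𝕀 (not (densityHolds i S k)))
  𝕀-not-good-suc≤ i S |S|≤h =
    split (length S ≤? h) (zeroGood S) (𝕀-not-all≤∑ (densityHolds i S) (range (length S) h))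
    where
    split : ∀ (p : Dec (length S ≤ h)) z {x s} → 𝕀 (not x) ≤ s → 𝕀 (not (does p ∧ z ∧ x)) ≤ 𝕀 (not z) + s
    split (yes _) false _ = s≤s z≤n
    split (yes _) true x≤s = x≤s
    split (no |S|≰h) z _ = ⊥-elim (|S|≰h |S|≤h)

  badMass-suc≤ : ∀ i k m → k ≤ h →
    badMass (suc i) k m ≤ nonZeroGoodMass k m + ∑ (range k h) (densityFailMass i k m)
  badMass-suc≤ i k m k≤h = begin
      badMass (suc i) k m
    ≤⟨ ∑-seqs-mono-≤ k pointwise ⟩
      ∑ (seqs G k) (λ T → 𝕀 (not (zeroGood T)) * nbhd G T ^ m + ∑ (range k h) (λ k′ → 𝕀 (not (densityHolds i T k′)) * nbhd G T ^ m))
    ≡⟨ ∑-distrib-+ (seqs G k) _ _ ⟩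
      nonZeroGoodMass k m + ∑ (seqs G k) (λ T → ∑ (range k h) (λ k′ → 𝕀 (not (densityHolds i T k′)) * nbhd G T ^ m))
    ≡⟨ cong (nonZeroGoodMass k m +_) (∑-comm (seqs G k) (range k h) _) ⟩
      nonZeroGoodMass k m + ∑ (range k h) (densityFailMass i k m) ∎
    where
    open ≤-Reasoning
    pointwise : ∀ T → length T ≡ k → 𝕀 (not (good (suc i) T)) * nbhd G T ^ m ≤
      𝕀 (not (zeroGood T)) * nbhd G T ^ m + ∑ (range k h) (λ k′ → 𝕀 (not (densityHolds i T k′)) * nbhd G T ^ m)
    pointwise T refl = begin
        𝕀 (not (good (suc i) T)) * nbhd G T ^ m
      ≤⟨ *-monoˡ-≤ (nbhd G T ^ m) (𝕀-not-good-suc≤ i T k≤h) ⟩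
        (𝕀 (not (zeroGood T)) + ∑ (range k h) (λ k′ → 𝕀 (not (densityHolds i T k′)))) * nbhd G T ^ m
      ≡⟨ *-distribʳ-+ (nbhd G T ^ m) (𝕀 (not (zeroGood T))) _ ⟩
        𝕀 (not (zeroGood T)) * nbhd G T ^ m + ∑ (range k h) (λ k′ → 𝕀 (not (densityHolds i T k′))) * nbhd G T ^ m
      ≡⟨ cong (𝕀 (not (zeroGood T)) * nbhd G T ^ m +_) (∑-*ʳ (range k h) _ _) ⟨
        𝕀 (not (zeroGood T)) * nbhd G T ^ m + ∑ (range k h) (λ k′ → 𝕀 (not (densityHolds i T k′)) * nbhd G T ^ m) ∎

  ∑-badCount≡badMass : ∀ i k k′ → ∑ (seqs G k) (λ T → badCount i T k′) ≡ badMass i k′ k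
  ∑-badCount≡badMass i k k′ = begin
      ∑ (seqs G k) (λ S → badCount i S k′)
    ≡⟨ ∑-cong (seqs G k) (λ S _ → trans (count≡∑𝕀 _ (seqs G k′))
         (∑-cong (seqs G k′) (λ T _ → 𝕀-∧ (all (inN G S) T) (not (good i T))))) ⟩
      ∑ (seqs G k) (λ S → ∑ (seqs G k′) (λ T → 𝕀 (all (inN G S) T) * 𝕀 (not (good i T))))
    ≡⟨ ∑-∑-inN≡∑-nbhd^ k k′ (λ T → 𝕀 (not (good i T))) ⟩
      ∑ (seqs G k′) (λ T → nbhd G T ^ k * 𝕀 (not (good i T)))
    ≡⟨ ∑-cong (seqs G k′) (λ T _ → *-comm (nbhd G T ^ k) (𝕀 (not (good i T)))) ⟩
      badMass i k′ k ∎
    where open ≡-Reasoning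

  ∑-range-≤ : ∀ a (f : ℕ → ℕ) c → (∀ k → a ≤ k → k ≤ h → f k ≤ c) → ∑ (range a h) f ≤ suc h * c
  ∑-range-≤ a f c f≤c = begin
      ∑ (range a h) f                                    ≡⟨ ∑-filterᵇ (λ k → does (a ≤? k)) f (upTo (suc h)) ⟩
      ∑ (upTo (suc h)) (λ k → 𝕀 (does (a ≤? k)) * f k)   ≤⟨ ∑-≤-length* (upTo (suc h)) c _ pointwise ⟩
      length (upTo (suc h)) * c                          ≡⟨ cong (_* c) (length-upTo (suc h)) ⟩
      suc h * c                                          ∎
    where
    open ≤-Reasoning
    pointwise : ∀ k → k ∈ upTo (suc h) → 𝕀 (does (a ≤? k)) * f k ≤ c
    pointwise k k∈ with a ≤ᵇ k in a≤ᵇk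
    ... | true = ≤-trans (≤-reflexive (+-identityʳ (f k)))
                         (f≤c k (≤ᵇ⇒≤ a k (subst T (sym a≤ᵇk) _)) (≤-pred (∈-upTo⁻ k∈)))
    ... | false = z≤n

  -- a / b stands for p, and scale k m = n^k (n (a / b)^k)^m · b^(km) is the m-th moment of
  -- |N(T)| over length-k sequences T that a random graph of density p would have.
  module Bounds (A B a b : ℕ) (n≥1 : 1 ≤ n) (a≥1 : 1 ≤ a) (B≥1 : 1 ≤ B)
    (not-zeroGood⇒ : ∀ T → zeroGood T ≡ false → nbhd G T * A * b ^ length T < a ^ length T * n)
    (density-fails⇒ : ∀ i T k → densityHolds i T k ≡ false → nbhd G T ^ k < B * badCount i T k) where

    open Boost B h

    scale : ℕ → ℕ → ℕ
    scale k m = n ^ (k + m) * a ^ (k * m)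

    nonZeroGoodMass-bound : ∀ k m → 1 ≤ m → nonZeroGoodMass k m * (A * b ^ (k * m)) ≤ scale k m
    nonZeroGoodMass-bound k m m≥1 = begin
        nonZeroGoodMass k m * (A * b ^ (k * m))
      ≡⟨ ∑-*ʳ (seqs G k) _ _ ⟨
        ∑ (seqs G k) (λ T → 𝕀 (not (zeroGood T)) * nbhd G T ^ m * (A * b ^ (k * m)))
      ≤⟨ ∑-seqs-≤ k _ _ pointwise ⟩
        n ^ k * (a ^ (k * m) * n ^ m)
      ≡⟨ scale-identity n a k m ⟩
        scale k m ∎
      where
      open ≤-Reasoning
      small : ∀ T z → (z ≡ false → nbhd G T * A * b ^ k < a ^ k * n) →
        𝕀 (not z) * nbhd G T ^ m * (A * b ^ (k * m)) ≤ a ^ (k * m) * n ^ m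
      small T true _ = z≤n
      small T false z⇒ = subst₂ _≤_
        (cong₂ (λ x y → x * (A * y)) (sym (+-identityʳ (nbhd G T ^ m))) (^-*-assoc b k m))
        (trans (^-distrib-* (a ^ k) n m) (cong (_* n ^ m) (^-*-assoc a k m)))
        (^-*-<⇒≤ (nbhd G T) A (b ^ k) (a ^ k * n) m m≥1 (z⇒ refl))
      pointwise : ∀ T → length T ≡ k → 𝕀 (not (zeroGood T)) * nbhd G T ^ m * (A * b ^ (k * m)) ≤ a ^ (k * m) * n ^ m
      pointwise T refl = small T (zeroGood T) (not-zeroGood⇒ T)

    densityFailMass-split : ∀ i k m e Γ → 1 ≤ m →
      densityFailMass i k m (m + e) * (Γ * (b ^ k) ^ m) * (a ^ k * n) ^ e
        ≤ n ^ k * ((a ^ k * n) ^ m * (a ^ k * n) ^ e) + Γ * (b ^ k) ^ m * B * (Γ * b ^ k) ^ e * badMass i (m + e) k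
    densityFailMass-split i k m e Γ m≥1 = begin
        densityFailMass i k m (m + e) * (Γ * c ^ m) * u ^ e
      ≡⟨ trans (∑-*ʳ (seqs G k) (u ^ e) (λ T → 𝕀 (not (densityHolds i T (m + e))) * nbhd G T ^ m * (Γ * c ^ m)))
               (cong (_* u ^ e) (∑-*ʳ (seqs G k) (Γ * c ^ m) (λ T → 𝕀 (not (densityHolds i T (m + e))) * nbhd G T ^ m))) ⟨
        ∑ (seqs G k) (λ T → 𝕀 (not (densityHolds i T (m + e))) * nbhd G T ^ m * (Γ * c ^ m) * u ^ e)
      ≤⟨ ∑-mono-≤ (seqs G k) (λ T _ → pointwise T (densityHolds i T (m + e)) (density-fails⇒ i T (m + e))) ⟩
        ∑ (seqs G k) (λ T → u ^ m * u ^ e + K * badCount i T (m + e))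
      ≡⟨ ∑-distrib-+ (seqs G k) _ _ ⟩
        ∑ (seqs G k) (λ T → u ^ m * u ^ e) + ∑ (seqs G k) (λ T → K * badCount i T (m + e))
      ≤⟨ +-mono-≤ (∑-seqs-≤ k _ (λ _ → u ^ m * u ^ e) (λ _ _ → ≤-refl))
                  (≤-reflexive (trans (∑-*ˡ (seqs G k) K _) (cong (K *_) (∑-badCount≡badMass i k (m + e))))) ⟩
        n ^ k * (u ^ m * u ^ e) + K * badMass i (m + e) k ∎
      where
      open ≤-Reasoning
      c = b ^ k
      u = a ^ k * n
      K = Γ * c ^ m * B * (Γ * c) ^ e
      regroup : ∀ x y z w v → x * y * z * v * w ≡ x * y * z * w * v
      regroup = solve-∀
      pointwise : ∀ T holds → (holds ≡ false → nbhd G T ^ (m + e) < B * badCount i T (m + e)) →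
        𝕀 (not holds) * nbhd G T ^ m * (Γ * c ^ m) * u ^ e ≤ u ^ m * u ^ e + K * badCount i T (m + e)
      pointwise T true _ = z≤n
      pointwise T false fails⇒ = subst₂ _≤_
        (cong (λ z → z * (Γ * c ^ m) * u ^ e) (sym (+-identityʳ (nbhd G T ^ m))))
        (cong (u ^ m * u ^ e +_) (regroup Γ (c ^ m) B ((Γ * c) ^ e) (badCount i T (m + e))))
        (dichotomy-≤ (nbhd G T) (badCount i T (m + e)) u Γ c B m e m≥1 (fails⇒ refl))

    densityFailMass-bound : ∀ i k m e F → 1 ≤ m → m + e ≤ h → 1 ≤ F →
      badMass i (m + e) k * b ^ ((m + e) * k) * (B * (2 * F) ^ suc h) ≤ scale (m + e) k →
      F * densityFailMass i k m (m + e) * b ^ (k * m) ≤ scale k m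
    densityFailMass-bound i k m e F m≥1 m+e≤h F≥1 IH =
      subst (λ z → F * densityFailMass i k m (m + e) * z ≤ scale k m) (^-*-assoc b k m)
        (combine-≤ (densityFailMass i k m (m + e)) Γ P U (scale k m) B Y Q (B * Γ ^ suc h) F (Γ ^ suc h)
          refl refl (1≤m^n Γ (suc h) Γ≥1) B≥1 (1≤m^n u e (*-mono-≤ (1≤m^n a k a≥1) n≥1))
          (Γ ^ suc e) (^-monoʳ-≤′ Γ Γ≥1 (s≤s (≤-trans (m≤n+m e m) m+e≤h)))
          H₁ H₂)
      where
      open ≤-Reasoning
      Γ = 2 * F
      Γ≥1 : 1 ≤ Γ
      Γ≥1 = ≤-trans F≥1 (m≤m+n F (F + 0))
      c = b ^ k
      u = a ^ k * n
      P = c ^ m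
      Q = c ^ e
      U = u ^ e
      Y = badMass i (m + e) k
      regroup : ∀ g p b gₑ q y → g * p * b * (gₑ * q) * y ≡ b * (g * gₑ) * (y * p * q)
      regroup = solve-∀
      n^k*u^m≡scale : n ^ k * u ^ m ≡ scale k m
      n^k*u^m≡scale = trans (cong (n ^ k *_) (trans (^-distrib-* (a ^ k) n m) (cong (_* n ^ m) (^-*-assoc a k m))))
                            (scale-identity n a k m)
      H₁ : densityFailMass i k m (m + e) * Γ * P * U ≤ scale k m * U + B * Γ ^ suc e * (Y * P * Q)
      H₁ = begin
          densityFailMass i k m (m + e) * Γ * P * U
        ≡⟨ cong (_* U) (*-assoc (densityFailMass i k m (m + e)) Γ P) ⟩
          densityFailMass i k m (m + e) * (Γ * P) * U
        ≤⟨ densityFailMass-split i k m e Γ m≥1 ⟩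
          n ^ k * (u ^ m * U) + Γ * P * B * (Γ * c) ^ e * Y
        ≡⟨ cong₂ _+_ (trans (sym (*-assoc (n ^ k) (u ^ m) U)) (cong (_* U) n^k*u^m≡scale))
                     (trans (cong (λ z → Γ * P * B * z * Y) (^-distrib-* Γ c e)) (regroup Γ P B (Γ ^ e) Q Y)) ⟩
          scale k m * U + B * Γ ^ suc e * (Y * P * Q) ∎
      H₂ : Y * P * Q * (B * Γ ^ suc h) ≤ scale k m * U
      H₂ = subst₂ _≤_
        (trans (cong (λ z → Y * z * (B * Γ ^ suc h))
                 (trans (cong (b ^_) (exponent m e k))
                   (trans (^-distribˡ-+-* b (k * m) (k * e)) (sym (cong₂ _*_ (^-*-assoc b k m) (^-*-assoc b k e))))))
               (cong (_* (B * Γ ^ suc h)) (sym (*-assoc Y P Q))))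
        (scale-+ n a k m e) IH
        where
        exponent : ∀ m e k → (m + e) * k ≡ k * m + k * e
        exponent = solve-∀

    -- Induction on i: a bad length-k sequence is not 0-good (cost 1/A) or violates the
    -- density condition at some k′ ∈ [k, h]; the latter mass is controlled by the bad mass
    -- at level i of length-k′ sequences, for which the hypothesis is applied with boost E.
    badMass-bound : ∀ i E → 1 ≤ E → iterate boost E i ≤ A → ∀ k m → 1 ≤ m → m ≤ k → k ≤ h →
      badMass i k m * b ^ (k * m) * E ≤ scale k m
    badMass-bound zero E E≥1 E≤A k m m≥1 m≤k k≤h = begin
        nonZeroGoodMass k m * b ^ (k * m) * E   ≡⟨ regroup (nonZeroGoodMass k m) (b ^ (k * m)) E ⟩
        nonZeroGoodMass k m * (E * b ^ (k * m)) ≤⟨ *-monoʳ-≤ (nonZeroGoodMass k m) (*-monoˡ-≤ (b ^ (k * m)) E≤A) ⟩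
        nonZeroGoodMass k m * (A * b ^ (k * m)) ≤⟨ nonZeroGoodMass-bound k m m≥1 ⟩
        scale k m                               ∎
      where
      open ≤-Reasoning
      regroup : ∀ x y z → x * y * z ≡ x * (z * y)
      regroup = solve-∀
    badMass-bound (suc i) E E≥1 iterate≤A k m m≥1 m≤k k≤h =
      *-cancelˡ-≤′ (badMass (suc i) k m * P * E) (scale k m) (suc (suc h)) (s≤s z≤n) (begin
          suc (suc h) * (badMass (suc i) k m * P * E)
        ≡⟨ regroup₁ (suc (suc h)) (badMass (suc i) k m) P E ⟩
          F * badMass (suc i) k m * P
        ≤⟨ *-monoˡ-≤ P (*-monoʳ-≤ F (badMass-suc≤ i k m k≤h)) ⟩
          F * (nonZeroGoodMass k m + ∑ (range k h) (densityFailMass i k m)) * P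
        ≡⟨ regroup₂ F (nonZeroGoodMass k m) (∑ (range k h) (densityFailMass i k m)) P ⟩
          nonZeroGoodMass k m * (F * P) + F * ∑ (range k h) (densityFailMass i k m) * P
        ≡⟨ cong (nonZeroGoodMass k m * (F * P) +_)
             (trans (∑-*ʳ (range k h) P (λ k′ → F * densityFailMass i k m k′))
                    (cong (_* P) (∑-*ˡ (range k h) F (densityFailMass i k m)))) ⟨
          nonZeroGoodMass k m * (F * P) + ∑ (range k h) (λ k′ → F * densityFailMass i k m k′ * P)
        ≤⟨ +-mono-≤ (≤-trans (*-monoʳ-≤ (nonZeroGoodMass k m) (*-monoˡ-≤ P F≤A)) (nonZeroGoodMass-bound k m m≥1))
                    (∑-range-≤ k _ (scale k m) failing-bound) ⟩
          scale k m + suc h * scale k m ∎)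
      where
      open ≤-Reasoning
      P = b ^ (k * m)
      F = suc (suc h) * E
      F≥1 : 1 ≤ F
      F≥1 = ≤-trans E≥1 (≤[h+2]* E)
      F≤A : F ≤ A
      F≤A = ≤-trans ([h+2]*≤boost B≥1 E) (≤-trans (≤iterate B≥1 i (boost E)) iterate≤A)
      boost≥1 : 1 ≤ boost E
      boost≥1 = ≤-trans F≥1 ([h+2]*≤boost B≥1 E)
      regroup₁ : ∀ H M P E → H * (M * P * E) ≡ H * E * M * P
      regroup₁ = solve-∀
      regroup₂ : ∀ F M S P → F * (M + S) * P ≡ M * (F * P) + F * S * P
      regroup₂ = solve-∀
      failing-bound : ∀ k′ → k ≤ k′ → k′ ≤ h → F * densityFailMass i k m k′ * P ≤ scale k m
      failing-bound k′ k≤k′ k′≤h = subst (λ l → F * densityFailMass i k m l * P ≤ scale k m) m+e≡k′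
        (densityFailMass-bound i k m e F m≥1 (subst (_≤ h) (sym m+e≡k′) k′≤h) F≥1
          (subst (λ l → badMass i l k * b ^ (l * k) * boost E ≤ scale l k) (sym m+e≡k′)
            (badMass-bound i (boost E) boost≥1 iterate≤A k′ k (≤-trans m≥1 m≤k) k≤k′ k′≤h)))
        where
        e = k′ ∸ m
        m+e≡k′ : m + e ≡ k′
        m+e≡k′ = m+[n∸m]≡n (≤-trans m≤k k≤k′)
module Constants (β : ℚ) (h r : ℕ) where

  open import Data.Nat
  open import Data.Nat.Properties
  open import Data.Nat.GeneralisedArithmetic using (iterate)
  open import Data.Rational using (↧ₙ_)
  open NatPowers using (1≤m^n)
  open Boost

  B : ℕ
  B = ↧ₙ β

  B≥1 : 1 ≤ B
  B≥1 = s≤s z≤n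

  T₀ : ℕ
  T₀ = 2 ^ (h * r) * B

  T₀≥1 : 1 ≤ T₀
  T₀≥1 = *-mono-≤ (1≤m^n 2 (h * r) (s≤s z≤n)) B≥1

  A : ℕ
  A = iterate (boost B h) T₀ h

  A≥1 : 1 ≤ A
  A≥1 = ≤-trans T₀≥1 (≤iterate B h B≥1 h T₀)

  α : ℚ
  α = divℕ 1 A
module Estimate {n : ℕ} (G : Graph n) (β : ℚ) (h r : ℕ) (r≥1 : 1 Data.Nat.≤ r) (β>0 : 0ℚ Data.Rational.< β) where

  import Data.Nat as ℕ
  open import Data.Nat using (zero; suc; z≤n; s≤s)
  import Data.Nat.Properties as ℕ
  open import Data.Nat.GeneralisedArithmetic using (iterate)
  open import Data.Bool using (true; false; _∧_; not)
  open import Data.List using (length)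
  open import Data.Bool.ListAction using (all)
  open import Data.Product using (proj₁; proj₂)
  open import Data.Empty using (⊥-elim)
  open import Data.Rational using (_≤_; _<_; _+_; _*_; _-_; -_; 0ℚ; 1ℚ; positive)
  open import Data.Rational.Properties using (≤-trans; ≤-<-trans; <⇒≤; ≤-reflexive; *-identityˡ;
    +-mono-≤; +-monoˡ-≤; +-monoʳ-<; neg-antimono-≤; neg-antimono-<; *-monoʳ-≤-nonNeg; *-monoˡ-≤-nonNeg;
    *-monoˡ-<-pos; *-cancelʳ-≤-pos; module ≤-Reasoning)
  open import Tactic.RingSolver using (solve-∀)
  import Data.Nat.Tactic.RingSolver as ℕ-Solver
  open import Relation.Binary.PropositionalEquality
  open Sums
  open NatPowers using (1≤m^n; m≤m^n)
  open NatToRational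
  open Counting G
  open NoRepetition G
  open Approximation using (root-approximation)
  open Rescaling
  open Boost using (iterate-+; ≤iterate)
  open Constants β h r
  open Goodness G α β h r
  open BadMass G α β h r

  D : ℕ
  D = degMoment r

  b : ℕ
  b = 2 ℕ.* n ℕ.^ suc r

  1/B≤β : divℕ 1 B ≤ β
  1/B≤β = divℕ-1-↧ₙ≤ β β>0

  fewGood⇒manyBad : ∀ good bad Y → ℕ→ℚ good < (1ℚ - β) * ℕ→ℚ Y → good ℕ.+ bad ≡ Y → Y ℕ.< B ℕ.* bad
  fewGood⇒manyBad good bad Y few split = subst (Y ℕ.<_) (ℕ.*-comm bad B) (ℕ→ℚ-cancel-< Y<bad*B)
    where
    complement : ∀ y b → y + - ((1ℚ - b) * y) ≡ b * y
    complement = solve-∀ ℚ-ring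
    cancel : ∀ g x → (g + x) + - g ≡ x
    cancel = solve-∀ ℚ-ring
    rotate : ∀ x y z → x * y * z ≡ x * (z * y)
    rotate = solve-∀ ℚ-ring
    βY<bad : β * ℕ→ℚ Y < ℕ→ℚ bad
    βY<bad = subst₂ _<_ (complement (ℕ→ℚ Y) β)
      (trans (cong (_+ - ℕ→ℚ good) (trans (cong ℕ→ℚ (sym split)) (ℕ→ℚ-+ good bad))) (cancel (ℕ→ℚ good) (ℕ→ℚ bad)))
      (+-monoʳ-< (ℕ→ℚ Y) (neg-antimono-< few))
    Y<bad*B : ℕ→ℚ Y < ℕ→ℚ (bad ℕ.* B)
    Y<bad*B = subst₂ _<_ (trans (rotate (divℕ 1 B) (ℕ→ℚ Y) (ℕ→ℚ B)) (divℕ-1-*-cancel B (ℕ→ℚ Y) B≥1)) (sym (ℕ→ℚ-* bad B))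
      (*-monoˡ-<-pos (ℕ→ℚ B) {{positive (0<ℕ→ℚ B B≥1)}}
        (≤-<-trans (*-monoʳ-≤-nonNeg (ℕ→ℚ Y) {{Data.Rational.nonNegative (0≤ℕ→ℚ Y)}} 1/B≤β) βY<bad))

  density-fails⇒ : ∀ i T k → densityHolds i T k ≡ false → nbhd G T ℕ.^ k ℕ.< B ℕ.* badCount i T k
  density-fails⇒ i T k fails = fewGood⇒manyBad goodCount (badCount i T k) (nbhd G T ℕ.^ k)
    (subst (λ z → ℕ→ℚ goodCount < (1ℚ - β) * z) (sym (ℕ→ℚ-^ (nbhd G T) k)) (≤ᵇ≡false⇒> fails))
    (count-∧+count-∧-not (good i) T k)
    where
    goodCount = count G (λ T′ → all (inN G T) T′ ∧ good i T′) (seqs G k)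

  module _ (n≥1 : 1 ℕ.≤ n) where

    b≥1 : 1 ℕ.≤ b
    b≥1 = ℕ.≤-trans (1≤m^n n (suc r) n≥1) (ℕ.m≤m+n _ _)

    t*n^[r+1]≡D : tStar G r * ℕ→ℚ (n ℕ.^ suc r) ≡ ℕ→ℚ D
    t*n^[r+1]≡D = divℕ-*-ℕ→ℚ D (n ℕ.^ suc r) (1≤m^n n (suc r) n≥1)

    t^k*n^[[r+1]k]≡D^k : ∀ k → tStar G r ^ℚ k * ℕ→ℚ (n ℕ.^ (suc r ℕ.* k)) ≡ ℕ→ℚ (D ℕ.^ k)
    t^k*n^[[r+1]k]≡D^k k = begin
        tStar G r ^ℚ k * ℕ→ℚ (n ℕ.^ (suc r ℕ.* k))
      ≡⟨ cong (tStar G r ^ℚ k *_) (trans (cong ℕ→ℚ (sym (ℕ.^-*-assoc n (suc r) k))) (ℕ→ℚ-^ (n ℕ.^ suc r) k)) ⟩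
        tStar G r ^ℚ k * ℕ→ℚ (n ℕ.^ suc r) ^ℚ k
      ≡⟨ ^ℚ-distrib-* (tStar G r) (ℕ→ℚ (n ℕ.^ suc r)) k ⟨
        (tStar G r * ℕ→ℚ (n ℕ.^ suc r)) ^ℚ k
      ≡⟨ trans (cong (_^ℚ k) t*n^[r+1]≡D) (sym (ℕ→ℚ-^ D k)) ⟩
        ℕ→ℚ (D ℕ.^ k) ∎
      where open ≡-Reasoning

    -- Clearing the denominators A^r and n^((r+1)|T|) of α^r t^|T| n^r.
    not-zeroGood⇒ : ∀ a → D ℕ.* b ℕ.^ r ℕ.≤ a ℕ.^ r ℕ.* n ℕ.^ suc r →
      ∀ T → zeroGood T ≡ false → nbhd G T ℕ.* A ℕ.* b ℕ.^ length T ℕ.< a ℕ.^ length T ℕ.* n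
    not-zeroGood⇒ a lower T fails =
      root-< d A b a n D r k b≥1 (ℕ→ℚ-*-cancel-< {d ℕ.^ r} small) lower
      where
      k = length T
      d = nbhd G T
      c≥1 : 1 ℕ.≤ A ℕ.^ r ℕ.* n ℕ.^ (suc r ℕ.* k)
      c≥1 = ℕ.*-mono-≤ (1≤m^n A r A≥1) (1≤m^n n (suc r ℕ.* k) n≥1)
      regroup : ∀ x y z u v → x * y * z * (u * v) ≡ (x * u) * (y * v) * z
      regroup = solve-∀ ℚ-ring
      cleared : α ^ℚ r * tStar G r ^ℚ k * ℕ→ℚ n ^ℚ r * ℕ→ℚ (A ℕ.^ r ℕ.* n ℕ.^ (suc r ℕ.* k)) ≡ ℕ→ℚ (D ℕ.^ k ℕ.* n ℕ.^ r)
      cleared = begin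
          α ^ℚ r * tStar G r ^ℚ k * ℕ→ℚ n ^ℚ r * ℕ→ℚ (A ℕ.^ r ℕ.* n ℕ.^ (suc r ℕ.* k))
        ≡⟨ cong (α ^ℚ r * tStar G r ^ℚ k * ℕ→ℚ n ^ℚ r *_)
             (trans (ℕ→ℚ-* (A ℕ.^ r) (n ℕ.^ (suc r ℕ.* k))) (cong (_* ℕ→ℚ (n ℕ.^ (suc r ℕ.* k))) (ℕ→ℚ-^ A r))) ⟩
          α ^ℚ r * tStar G r ^ℚ k * ℕ→ℚ n ^ℚ r * (ℕ→ℚ A ^ℚ r * ℕ→ℚ (n ℕ.^ (suc r ℕ.* k)))
        ≡⟨ regroup (α ^ℚ r) (tStar G r ^ℚ k) (ℕ→ℚ n ^ℚ r) (ℕ→ℚ A ^ℚ r) (ℕ→ℚ (n ℕ.^ (suc r ℕ.* k))) ⟩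
          α ^ℚ r * ℕ→ℚ A ^ℚ r * (tStar G r ^ℚ k * ℕ→ℚ (n ℕ.^ (suc r ℕ.* k))) * ℕ→ℚ n ^ℚ r
        ≡⟨ cong₂ (λ x y → x * y * ℕ→ℚ n ^ℚ r)
             (trans (sym (^ℚ-distrib-* α (ℕ→ℚ A) r)) (trans (cong (_^ℚ r) (divℕ-*-ℕ→ℚ 1 A A≥1)) (1^ℚ r)))
             (t^k*n^[[r+1]k]≡D^k k) ⟩
          1ℚ * ℕ→ℚ (D ℕ.^ k) * ℕ→ℚ n ^ℚ r
        ≡⟨ trans (cong (_* ℕ→ℚ n ^ℚ r) (*-identityˡ (ℕ→ℚ (D ℕ.^ k)))) (cong (ℕ→ℚ (D ℕ.^ k) *_) (sym (ℕ→ℚ-^ n r))) ⟩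
          ℕ→ℚ (D ℕ.^ k) * ℕ→ℚ (n ℕ.^ r)
        ≡⟨ ℕ→ℚ-* (D ℕ.^ k) (n ℕ.^ r) ⟨
          ℕ→ℚ (D ℕ.^ k ℕ.* n ℕ.^ r) ∎
        where open ≡-Reasoning
      small : ℕ→ℚ (d ℕ.^ r) * ℕ→ℚ (A ℕ.^ r ℕ.* n ℕ.^ (suc r ℕ.* k)) < ℕ→ℚ (D ℕ.^ k ℕ.* n ℕ.^ r)
      small = subst (ℕ→ℚ (d ℕ.^ r) * ℕ→ℚ (A ℕ.^ r ℕ.* n ℕ.^ (suc r ℕ.* k)) <_) cleared
        (*-monoˡ-<-pos (ℕ→ℚ (A ℕ.^ r ℕ.* n ℕ.^ (suc r ℕ.* k))) {{positive (0<ℕ→ℚ _ c≥1)}}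
          (≤ᵇ≡false⇒> {α ^ℚ r * tStar G r ^ℚ k * ℕ→ℚ n ^ℚ r} {ℕ→ℚ (d ℕ.^ r)} fails))

    dense⇒[4j]^r*n^r<D : ∀ j → ℕ→ℚ ((4 ℕ.* j) ℕ.^ r) < tStar G r * ℕ→ℚ n → (4 ℕ.* j) ℕ.^ r ℕ.* n ℕ.^ r ℕ.< D
    dense⇒[4j]^r*n^r<D j dense = ℕ→ℚ-*-cancel-< {(4 ℕ.* j) ℕ.^ r}
      (subst (ℕ→ℚ ((4 ℕ.* j) ℕ.^ r) * ℕ→ℚ (n ℕ.^ r) <_)
        (trans (assoc (tStar G r) (ℕ→ℚ n) (ℕ→ℚ (n ℕ.^ r))) (trans (cong (tStar G r *_) (sym (ℕ→ℚ-* n (n ℕ.^ r)))) t*n^[r+1]≡D))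
        (*-monoˡ-<-pos (ℕ→ℚ (n ℕ.^ r)) {{positive (0<ℕ→ℚ _ (1≤m^n n r n≥1))}} dense))
      where
      assoc : ∀ x y z → x * y * z ≡ x * (y * z)
      assoc = solve-∀ ℚ-ring

    dense⇒2*[n^r*k]≤D : ∀ k → ℕ→ℚ ((4 ℕ.* k) ℕ.^ r) < tStar G r * ℕ→ℚ n → 2 ℕ.* (n ℕ.^ r ℕ.* k) ℕ.≤ D
    dense⇒2*[n^r*k]≤D k dense = ℕ.<⇒≤ (ℕ.≤-<-trans
      (ℕ.≤-trans (ℕ.≤-reflexive (regroup (n ℕ.^ r) k))
        (ℕ.*-monoˡ-≤ (n ℕ.^ r) (ℕ.≤-trans (ℕ.*-monoˡ-≤ k {2} {4} (s≤s (s≤s z≤n))) (m≤m^n (4 ℕ.* k) r r≥1))))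
      (dense⇒[4j]^r*n^r<D k dense))
      where
      regroup : ∀ x k → 2 ℕ.* (x ℕ.* k) ≡ 2 ℕ.* k ℕ.* x
      regroup = ℕ-Solver.solve-∀

    n^[k+r]*D^k≤noRepMass : ∀ j → 2 ℕ.* (n ℕ.^ r ℕ.* suc j) ℕ.≤ D →
      n ℕ.^ (suc j ℕ.+ r) ℕ.* D ℕ.^ suc j ℕ.≤ 2 ℕ.^ suc (suc j) ℕ.* (noRepMass (suc j) r ℕ.* n ℕ.^ (suc r ℕ.* suc j))
    n^[k+r]*D^k≤noRepMass j D-large =
      ℕ.≤-trans (noRepMass-rescaled n D r j X (degMoment^≤noRepMass j r D-large))
        (ℕ.≤-trans (ℕ.*-monoˡ-≤ N (ℕ.*-monoˡ-≤ X (ℕ.m≤m+n (2 ℕ.^ suc j) _)))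
                   (ℕ.≤-reflexive (ℕ.*-assoc (2 ℕ.^ suc (suc j)) X N)))
      where
      X = noRepMass (suc j) r
      N = n ℕ.^ (suc r ℕ.* suc j)

    rescale : ∀ c k → c * ℕ→ℚ (n ℕ.^ (k ℕ.+ r)) * (tStar G r ^ℚ k) * ℕ→ℚ (n ℕ.^ (suc r ℕ.* k))
                        ≡ c * ℕ→ℚ (n ℕ.^ (k ℕ.+ r) ℕ.* D ℕ.^ k)
    rescale c k = begin
        c * ℕ→ℚ (n ℕ.^ (k ℕ.+ r)) * (tStar G r ^ℚ k) * ℕ→ℚ (n ℕ.^ (suc r ℕ.* k))
      ≡⟨ assoc c (ℕ→ℚ (n ℕ.^ (k ℕ.+ r))) (tStar G r ^ℚ k) (ℕ→ℚ (n ℕ.^ (suc r ℕ.* k))) ⟩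
        c * (ℕ→ℚ (n ℕ.^ (k ℕ.+ r)) * (tStar G r ^ℚ k * ℕ→ℚ (n ℕ.^ (suc r ℕ.* k))))
      ≡⟨ cong (λ z → c * (ℕ→ℚ (n ℕ.^ (k ℕ.+ r)) * z)) (t^k*n^[[r+1]k]≡D^k k) ⟩
        c * (ℕ→ℚ (n ℕ.^ (k ℕ.+ r)) * ℕ→ℚ (D ℕ.^ k))
      ≡⟨ cong (c *_) (ℕ→ℚ-* (n ℕ.^ (k ℕ.+ r)) (D ℕ.^ k)) ⟨
        c * ℕ→ℚ (n ℕ.^ (k ℕ.+ r) ℕ.* D ℕ.^ k) ∎
      where
      open ≡-Reasoning
      assoc : ∀ c w x y → c * w * x * y ≡ c * (w * (x * y))
      assoc = solve-∀ ℚ-ring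

    -- Starting from E = boost^(h ∸ i) T₀ ≥ T₀, another i boosts reach exactly A.
    badMass≤ : ∀ a → 1 ℕ.≤ a → D ℕ.* b ℕ.^ r ℕ.≤ a ℕ.^ r ℕ.* n ℕ.^ suc r → a ℕ.^ r ℕ.* n ℕ.^ suc r ℕ.≤ 2 ℕ.^ r ℕ.* D ℕ.* b ℕ.^ r →
      ∀ i k → i ℕ.≤ h → r ℕ.≤ k → k ℕ.≤ h → badMass i k r ℕ.* B ℕ.* n ℕ.^ (suc r ℕ.* k) ℕ.≤ n ℕ.^ (k ℕ.+ r) ℕ.* D ℕ.^ k
    badMass≤ a a≥1 lower upper i k i≤h r≤k k≤h = badMass-rescaled (badMass i k r) B b a n D k r h b≥1 k≤h
      (ℕ.≤-trans (ℕ.*-monoʳ-≤ (badMass i k r ℕ.* b ℕ.^ (k ℕ.* r)) T₀≤E)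
                 (badMass-bound i E (ℕ.≤-trans T₀≥1 T₀≤E) (ℕ.≤-reflexive iterate≡A) k r r≥1 r≤k k≤h))
      upper
      where
      open Bounds A B a b n≥1 a≥1 B≥1 (not-zeroGood⇒ a lower) density-fails⇒
      open Boost B h using (boost)
      E = iterate boost T₀ (h ℕ.∸ i)
      T₀≤E : T₀ ℕ.≤ E
      T₀≤E = ≤iterate B h B≥1 (h ℕ.∸ i) T₀
      iterate≡A : iterate boost E i ≡ A
      iterate≡A = trans (sym (iterate-+ B h (h ℕ.∸ i) i T₀)) (cong (iterate boost T₀) (ℕ.m∸n+n≡m i≤h))

  noRepMass≤sumAstar+badMass : ∀ i j → noRepMass j r ℕ.≤ sumAstar i j ℕ.+ badMass i j r
  noRepMass≤sumAstar+badMass i j = ℕ.≤-trans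
    (∑-mono-≤ (seqs G j) (λ T _ → split (good i T) (noRep G T) (nbhd G T ℕ.^ r)))
    (ℕ.≤-reflexive (trans (∑-distrib-+ (seqs G j) _ _)
      (cong (ℕ._+ badMass i j r) (sym (∑-filterᵇ (λ S → good i S ∧ noRep G S) (λ S → nbhd G S ℕ.^ r) (seqs G j))))))
    where
    split : ∀ g nr x → 𝕀 nr ℕ.* x ℕ.≤ 𝕀 (g ∧ nr) ℕ.* x ℕ.+ 𝕀 (not g) ℕ.* x
    split true true x = ℕ.m≤m+n (1 ℕ.* x) 0
    split true false x = z≤n
    split false true x = ℕ.≤-refl
    split false false x = z≤n

  combine-ℚ : ∀ m V X Y S N → 1 ℕ.≤ m → 1 ℕ.≤ N →
    V ℕ.≤ m ℕ.* (X ℕ.* N) → Y ℕ.* B ℕ.* N ℕ.≤ V → X ℕ.≤ S ℕ.+ Y →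
    (divℕ 1 m - β) * ℕ→ℚ V ≤ ℕ→ℚ S * ℕ→ℚ N
  combine-ℚ m V X Y S N m≥1 N≥1 V≤ Y≤ X≤ = begin
      (divℕ 1 m - β) * ℕ→ℚ V
    ≡⟨ distrib (divℕ 1 m) β (ℕ→ℚ V) ⟩
      divℕ 1 m * ℕ→ℚ V + - (β * ℕ→ℚ V)
    ≤⟨ +-mono-≤ cV≤XN (neg-antimono-≤ YN≤βV) ⟩
      ℕ→ℚ (X ℕ.* N) + - ℕ→ℚ (Y ℕ.* N)
    ≤⟨ +-monoˡ-≤ (- ℕ→ℚ (Y ℕ.* N)) (subst (ℕ→ℚ (X ℕ.* N) ≤_) (ℕ→ℚ-+ (S ℕ.* N) (Y ℕ.* N))
         (ℕ→ℚ-mono-≤ (ℕ.≤-trans (ℕ.*-monoˡ-≤ N X≤) (ℕ.≤-reflexive (ℕ.*-distribʳ-+ N S Y))))) ⟩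
      ℕ→ℚ (S ℕ.* N) + ℕ→ℚ (Y ℕ.* N) + - ℕ→ℚ (Y ℕ.* N)
    ≡⟨ trans (cancel (ℕ→ℚ (S ℕ.* N)) (ℕ→ℚ (Y ℕ.* N))) (ℕ→ℚ-* S N) ⟩
      ℕ→ℚ S * ℕ→ℚ N ∎
    where
    open ≤-Reasoning
    distrib : ∀ c b v → (c + - b) * v ≡ c * v + - (b * v)
    distrib = solve-∀ ℚ-ring
    cancel : ∀ x y → x + y + - y ≡ x
    cancel = solve-∀ ℚ-ring
    rotate : ∀ i x b → i * (x * b) ≡ i * (b * x)
    rotate = solve-∀ ℚ-ring
    cV≤XN : divℕ 1 m * ℕ→ℚ V ≤ ℕ→ℚ (X ℕ.* N)
    cV≤XN = ≤-trans (*-monoˡ-≤-nonNeg (divℕ 1 m) {{Data.Rational.nonNegative (<⇒≤ (0<divℕ-1 m m≥1))}} (ℕ→ℚ-mono-≤ V≤))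
      (≤-reflexive (trans (cong (divℕ 1 m *_) (ℕ→ℚ-* m (X ℕ.* N))) (divℕ-1-*-cancel m _ m≥1)))
    YN≤βV : ℕ→ℚ (Y ℕ.* N) ≤ β * ℕ→ℚ V
    YN≤βV = begin
        ℕ→ℚ (Y ℕ.* N)
      ≡⟨ divℕ-1-*-cancel B (ℕ→ℚ (Y ℕ.* N)) B≥1 ⟨
        divℕ 1 B * (ℕ→ℚ B * ℕ→ℚ (Y ℕ.* N))
      ≡⟨ cong (divℕ 1 B *_) (trans (sym (ℕ→ℚ-* B (Y ℕ.* N))) (cong ℕ→ℚ (regroup B Y N))) ⟩
        divℕ 1 B * ℕ→ℚ (Y ℕ.* B ℕ.* N)
      ≤⟨ *-monoˡ-≤-nonNeg (divℕ 1 B) {{Data.Rational.nonNegative (<⇒≤ (0<divℕ-1 B B≥1))}} (ℕ→ℚ-mono-≤ Y≤) ⟩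
        divℕ 1 B * ℕ→ℚ V
      ≤⟨ *-monoʳ-≤-nonNeg (ℕ→ℚ V) {{Data.Rational.nonNegative (0≤ℕ→ℚ V)}} 1/B≤β ⟩
        β * ℕ→ℚ V ∎
      where
      regroup : ∀ b y m → b ℕ.* (y ℕ.* m) ≡ y ℕ.* b ℕ.* m
      regroup = ℕ-Solver.solve-∀

  sumAstar-bound : ∀ i j → i ℕ.≤ h → r ℕ.≤ j → j ℕ.≤ h → ℕ→ℚ ((4 ℕ.* j) ℕ.^ r) < tStar G r * ℕ→ℚ n →
    (divℕ 1 (2 ℕ.^ suc j) - β) * ℕ→ℚ (n ℕ.^ (j ℕ.+ r)) * (tStar G r ^ℚ j) ≤ ℕ→ℚ (sumAstar i j)
  sumAstar-bound i zero i≤h r≤0 _ _ = ⊥-elim (ℕ.<⇒≱ r≥1 r≤0)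
  sumAstar-bound i (suc j) i≤h r≤k k≤h dense =
    *-cancelʳ-≤-pos (ℕ→ℚ N) {{positive (0<ℕ→ℚ N N≥1)}}
      (subst (_≤ ℕ→ℚ (sumAstar i k) * ℕ→ℚ N) (sym (rescale n≥1 (divℕ 1 (2 ℕ.^ suc k) - β) k))
        (combine-ℚ (2 ℕ.^ suc k) (n ℕ.^ (k ℕ.+ r) ℕ.* D ℕ.^ k) (noRepMass k r) (badMass i k r) (sumAstar i k) N (1≤m^n 2 (suc k) (s≤s z≤n)) N≥1
          (n^[k+r]*D^k≤noRepMass n≥1 j (dense⇒2*[n^r*k]≤D n≥1 k dense))
          (badMass≤ n≥1 a a≥1 lower upper i k i≤h r≤k k≤h)
          (noRepMass≤sumAstar+badMass i k)))
    where
    k = suc j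
    N = n ℕ.^ (suc r ℕ.* k)
    n≥1 = ℕ→ℚ<*ℕ→ℚ⇒1≤ ((4 ℕ.* k) ℕ.^ r) (tStar G r) n dense
    N≥1 = 1≤m^n n (suc r ℕ.* k) n≥1
    approximant = root-approximation r D (n ℕ.^ suc r) b r≥1
      (ℕ.≤-trans (s≤s z≤n) (dense⇒[4j]^r*n^r<D n≥1 k dense)) (∑-deg^≤ r)
      (ℕ.m<m+n _ (ℕ.≤-trans (1≤m^n n (suc r) n≥1) (ℕ.m≤m+n _ 0)))
    a = proj₁ approximant
    a≥1 = proj₁ (proj₂ approximant)
    lower = proj₁ (proj₂ (proj₂ approximant))
    upper = proj₂ (proj₂ (proj₂ approximant))

open import Data.Nat as ℕ using (ℕ; suc; _≤_)
open import Data.Product using (∃; _×_; _,_)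
open import Data.Rational as ℚ using (ℚ; 0ℚ; 1ℚ; _*_; _-_)

lemma3p6 : (h r : ℕ) → 1 ≤ r → r ≤ h → (β : ℚ) → 0ℚ ℚ.< β → β ℚ.< 1ℚ →
    ∃ λ (α : ℚ) → 0ℚ ℚ.< α ×
      (∀ (n : ℕ) (G : Graph n) (i j : ℕ) → 1 ≤ i → i ≤ h → r ≤ j → j ≤ h →
        ℕ→ℚ ((4 ℕ.* j) ℕ.^ r) ℚ.< tStar G r * ℕ→ℚ n →
        (divℕ 1 (2 ℕ.^ suc j) - β) * ℕ→ℚ (n ℕ.^ (j ℕ.+ r)) * (tStar G r ^ℚ j)
          ℚ.≤ ℕ→ℚ (Goodness.sumAstar G α β h r i j))
lemma3p6 h r r≥1 r≤h β β>0 _ =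
  α , NatToRational.0<divℕ-1 A A≥1 ,
  λ n G i j _ i≤h r≤j j≤h dense → Estimate.sumAstar-bound G β h r r≥1 β>0 i j i≤h r≤j j≤h dense
  where open Constants β h r
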